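{- For any $i\in\omega$, the family $[S]_i$ is closed-r.e.-generic, where $S$ is the set of axioms of Peano arithmetic for $\mathcal{L}_{\mathrm{PA}}(\omega)$ (the Peano axioms with the induction schema extended to all $\mathcal{L}_{\mathrm{PA}}(\omega)$-formulas).
   Context: Base logic: first-order logic extended by unary operators $\Box$ (formulas $\Box\phi$, $\mathrm{FV}(\Box\phi)=\mathrm{FV}(\phi)$); a structure additionally assigns a truth value $\mathscr{M}\models\Box\phi[s]$ to each operator, formula and assignment, independent of $s(x)$ for $x\notin\mathrm{FV}(\phi)$, invariant under alphabetic variants, and respecting variable substitution. $\mathcal{L}_{\mathrm{PA}}(\omega)$ is the language of arithmetic ($0,S,+,\cdot$) plus operators $\Box_i$, $i\in\omega$. $\phi^s$ is $\phi$ with each free variable $x$ replaced by the numeral $\overline{s(x)}$. For a family $\mathbf{U}=(U_i)_{i\in\omega}$ of $\mathcal{L}_{\mathrm{PA}}(\omega)$-theories (sets of sentences), $\mathscr{M}_{\mathbf{U}}$ has universe $\mathbb{N}$, standard arithmetic, and $\mathscr{M}_{\mathbf{U}}\models\Box_i\phi[s]$ iff $U_i\models\phi^s$. $\mathbf{U}$ is closed if $\Box_i\phi\in U_i$ whenever $\phi\in U_i$; r.e. if $\{(\phi,i):\phi\in U_i\}$ is r.e. A family $\mathbf{T}$ is closed-r.e.-generic if it is r.e. and $\mathscr{M}_{\mathbf{U}}\models T_k$ for all $k$ whenever $\mathbf{U}\supseteq\mathbf{T}$ (componentwise) is a closed r.e. family. $[S]_i$ is the family with $S$ at index $i$ and $\emptyset$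 elsewhere. -}

module Defs where

open import Level using (Level; Lift) renaming (zero to lzero; suc to lsuc)
open import Data.Nat using (ℕ; zero; suc; _+_; _*_; _^_; _⊔_; _∸_)
open import Data.Fin using (Fin)
open import Data.Vec using (Vec; []; _∷_; lookup)
open import Data.Product using (Σ; ∃; _×_; _,_)
open import Data.Sum using (_⊎_)
open import Data.Empty using (⊥)
open import Relation.Nullary using (¬_)
open import Relation.Binary.PropositionalEquality using (_≡_)
open import Function using (_∘_)
open import Function.Bundles using (_⇔_)

-- Syntax of L_PA(ω): de Bruijn indices (alphabetic variants coincide)

data Term : Set where
  var  : ℕ → Term
  zer  : Term
  S    : Term → Term
  _⊕_  : Term → Term → Term
  _⊗_  : Term → Term → Term

infixr 5 _⇒_
infixr 6 _∧_ _∨_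
infix 7 _==_

data Formula : Set where
  _==_ : Term → Term → Formula
  ⊥'   : Formula
  _⇒_  : Formula → Formula → Formula
  _∧_  : Formula → Formula → Formula
  _∨_  : Formula → Formula → Formula
  ∀'   : Formula → Formula
  ∃'   : Formula → Formula
  □    : ℕ → Formula → Formula

¬' : Formula → Formula
¬' φ = φ ⇒ ⊥'

freeT : ℕ → Term → Set
freeT x (var y) = x ≡ y
freeT x zer = ⊥
freeT x (S t) = freeT x t
freeT x (t ⊕ u) = freeT x t ⊎ freeT x u
freeT x (t ⊗ u) = freeT x t ⊎ freeT x u

free : ℕ → Formula → Set
free x (t == u) = freeT x t ⊎ freeT x u
free x ⊥' = ⊥
free x (φ ⇒ ψ) = free x φ ⊎ free x ψ
free x (φ ∧ ψ) = free x φ ⊎ free x ψ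
free x (φ ∨ ψ) = free x φ ⊎ free x ψ
free x (∀' φ) = free (suc x) φ
free x (∃' φ) = free (suc x) φ
free x (□ i φ) = free x φ

Sentence : Formula → Set
Sentence φ = ∀ x → ¬ free x φ

-- an upper bound (exact: 1 + largest free index, or 0) on the free variables
boundT : Term → ℕ
boundT (var x) = suc x
boundT zer = 0
boundT (S t) = boundT t
boundT (t ⊕ u) = boundT t ⊔ boundT u
boundT (t ⊗ u) = boundT t ⊔ boundT u

bound : Formula → ℕ
bound (t == u) = boundT t ⊔ boundT u
bound ⊥' = 0
bound (φ ⇒ ψ) = bound φ ⊔ bound ψ
bound (φ ∧ ψ) = bound φ ⊔ bound ψ
bound (φ ∨ ψ) = bound φ ⊔ bound ψ
bound (∀' φ) = bound φ ∸ 1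
bound (∃' φ) = bound φ ∸ 1
bound (□ i φ) = bound φ

extR : (ℕ → ℕ) → ℕ → ℕ
extR ρ zero = zero
extR ρ (suc x) = suc (ρ x)

renT : (ℕ → ℕ) → Term → Term
renT ρ (var x) = var (ρ x)
renT ρ zer = zer
renT ρ (S t) = S (renT ρ t)
renT ρ (t ⊕ u) = renT ρ t ⊕ renT ρ u
renT ρ (t ⊗ u) = renT ρ t ⊗ renT ρ u

ren : (ℕ → ℕ) → Formula → Formula
ren ρ (t == u) = renT ρ t == renT ρ u
ren ρ ⊥' = ⊥'
ren ρ (φ ⇒ ψ) = ren ρ φ ⇒ ren ρ ψ
ren ρ (φ ∧ ψ) = ren ρ φ ∧ ren ρ ψ
ren ρ (φ ∨ ψ) = ren ρ φ ∨ ren ρ ψ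
ren ρ (∀' φ) = ∀' (ren (extR ρ) φ)
ren ρ (∃' φ) = ∃' (ren (extR ρ) φ)
ren ρ (□ i φ) = □ i (ren ρ φ)

extS : (ℕ → Term) → ℕ → Term
extS σ zero = var zero
extS σ (suc x) = renT suc (σ x)

subT : (ℕ → Term) → Term → Term
subT σ (var x) = σ x
subT σ zer = zer
subT σ (S t) = S (subT σ t)
subT σ (t ⊕ u) = subT σ t ⊕ subT σ u
subT σ (t ⊗ u) = subT σ t ⊗ subT σ u

sub : (ℕ → Term) → Formula → Formula
sub σ (t == u) = subT σ t == subT σ u
sub σ ⊥' = ⊥'
sub σ (φ ⇒ ψ) = sub σ φ ⇒ sub σ ψ
sub σ (φ ∧ ψ) = sub σ φ ∧ sub σ ψ
sub σ (φ ∨ ψ) = sub σ φ ∨ sub σ ψ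
sub σ (∀' φ) = ∀' (sub (extS σ) φ)
sub σ (∃' φ) = ∃' (sub (extS σ) φ)
sub σ (□ i φ) = □ i (sub σ φ)

numeral : ℕ → Term
numeral zero = zer
numeral (suc n) = S (numeral n)

_^^_ : Formula → (ℕ → ℕ) → Formula
φ ^^ s = sub (λ x → numeral (s x)) φ

record PreStructure (ℓ : Level) : Set (lsuc ℓ) where
  field
    D    : Set
    z    : D
    sc   : D → D
    pl   : D → D → D
    tm   : D → D → D
    box  : ℕ → Formula → (ℕ → D) → Set ℓ

_∷ₛ_ : {A : Set} → A → (ℕ → A) → ℕ → A
(a ∷ₛ s) zero = a
(a ∷ₛ s) (suc x) = s x

module _ {ℓ : Level} (M : PreStructure ℓ) where
  open PreStructure M

  ⟦_⟧ : Term → (ℕ → D) → D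
  ⟦ var x ⟧ s = s x
  ⟦ zer ⟧ s = z
  ⟦ S t ⟧ s = sc (⟦ t ⟧ s)
  ⟦ t ⊕ u ⟧ s = pl (⟦ t ⟧ s) (⟦ u ⟧ s)
  ⟦ t ⊗ u ⟧ s = tm (⟦ t ⟧ s) (⟦ u ⟧ s)

  Sat : (ℕ → D) → Formula → Set ℓ
  Sat s (t == u) = Lift ℓ (⟦ t ⟧ s ≡ ⟦ u ⟧ s)
  Sat s ⊥' = Lift ℓ ⊥
  Sat s (φ ⇒ ψ) = Sat s φ → Sat s ψ
  Sat s (φ ∧ ψ) = Sat s φ × Sat s ψ
  Sat s (φ ∨ ψ) = Sat s φ ⊎ Sat s ψ
  Sat s (∀' φ) = (d : D) → Sat (d ∷ₛ s) φ
  Sat s (∃' φ) = Σ D λ d → Sat (d ∷ₛ s) φ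
  Sat s (□ i φ) = box i φ s

  Models : Formula → Set ℓ
  Models φ = (s : ℕ → D) → Sat s φ

-- Invariance under alphabetic variants is automatic (de Bruijn syntax).
record Structure : Set₁ where
  field
    pre : PreStructure lzero
  open PreStructure pre
  field
    box-FV  : ∀ i φ (s s' : ℕ → D) → (∀ x → free x φ → s x ≡ s' x) →
              box i φ s ⇔ box i φ s'
    box-ren : ∀ i φ (ρ : ℕ → ℕ) (s : ℕ → D) →
              box i (ren ρ φ) s ⇔ box i φ (s ∘ ρ)

Theory : Set₁
Theory = Formula → Set

_⊨_ : Theory → Formula → Set₁
U ⊨ φ = (M : Structure) → (∀ ψ → U ψ → Models (Structure.pre M) ψ) →
        Models (Structure.pre M) φ

Family : Set₁
Family = ℕ → Theory

SentenceFamily : Family → Set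
SentenceFamily U = ∀ i φ → U i φ → Sentence φ

_⊆F_ : Family → Family → Set
T ⊆F U = ∀ i φ → T i φ → U i φ

𝓜 : Family → PreStructure (lsuc lzero)
𝓜 U = record
  { D = ℕ ; z = 0 ; sc = suc ; pl = _+_ ; tm = _*_
  ; box = λ i φ s → U i ⊨ (φ ^^ s) }

ClosedFamily : Family → Set
ClosedFamily U = ∀ i φ → U i φ → U i (□ i φ)

data PR : ℕ → Set where
  Z    : ∀ {n} → PR n
  Succ : PR 1
  Proj : ∀ {n} → Fin n → PR n
  Comp : ∀ {m n} → PR m → Vec (PR n) m → PR n
  Rec  : ∀ {n} → PR n → PR (suc (suc n)) → PR (suc n)

mutual
  evalPR : ∀ {n} → PR n → Vec ℕ n → ℕ
  evalPR Z xs = 0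
  evalPR Succ (x ∷ []) = suc x
  evalPR (Proj i) xs = lookup xs i
  evalPR (Comp f gs) xs = evalPR f (evalPRs gs xs)
  evalPR (Rec g h) (zero ∷ xs) = evalPR g xs
  evalPR (Rec g h) (suc k ∷ xs) = evalPR h (k ∷ evalPR (Rec g h) (k ∷ xs) ∷ xs)

  evalPRs : ∀ {m n} → Vec (PR n) m → Vec ℕ n → Vec ℕ m
  evalPRs [] xs = []
  evalPRs (g ∷ gs) xs = evalPR g xs ∷ evalPRs gs xs

-- a set of naturals is r.e. iff it is Σ⁰₁: the projection of a
-- primitive recursive relation
RE : ∀ {ℓ} → (ℕ → Set ℓ) → Set ℓ
RE P = Σ (PR 2) λ R → ∀ n → P n ⇔ (∃ λ m → ¬ evalPR R (n ∷ m ∷ []) ≡ 0)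

pair : ℕ → ℕ → ℕ
pair a b = 2 ^ a * (2 * b + 1)

codeT : Term → ℕ
codeT (var x) = pair 0 x
codeT zer = pair 1 0
codeT (S t) = pair 2 (codeT t)
codeT (t ⊕ u) = pair 3 (pair (codeT t) (codeT u))
codeT (t ⊗ u) = pair 4 (pair (codeT t) (codeT u))

code : Formula → ℕ
code (t == u) = pair 0 (pair (codeT t) (codeT u))
code ⊥' = pair 1 0
code (φ ⇒ ψ) = pair 2 (pair (code φ) (code ψ))
code (φ ∧ ψ) = pair 3 (pair (code φ) (code ψ))
code (φ ∨ ψ) = pair 4 (pair (code φ) (code ψ))
code (∀' φ) = pair 5 (code φ)
code (∃' φ) = pair 6 (code φ)
code (□ i φ) = pair 7 (pair i (code φ))

REFamily : Family → Set
REFamily U = RE λ n → Σ Formula λ φ → Σ ℕ λ i → n ≡ pair (code φ) i × U i φ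

ClosedREGeneric : Family → Set₁
ClosedREGeneric T =
  Σ (REFamily T) λ _ →
  ((U : Family) → SentenceFamily U → ClosedFamily U → REFamily U → T ⊆F U →
   ∀ k φ → T k φ → Models (𝓜 U) φ)

[_]at_ : Theory → ℕ → Family
([ S' ]at i) k φ = k ≡ i × S' φ

v0 v1 : Term
v0 = var 0
v1 = var 1

-- induction body for φ (induction variable = index 0, parameters = 1,2,...):
-- (φ(0) ∧ ∀x (φ(x) → φ(Sx))) → ∀x φ(x)
indBody : Formula → Formula
indBody φ =
  (sub (zer ∷ₛ var) φ ∧ ∀' (φ ⇒ sub (S v0 ∷ₛ (var ∘ suc)) φ)) ⇒ ∀' φ

alls : ℕ → Formula → Formula
alls zero φ = φ
alls (suc n) φ = ∀' (alls n φ)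

closure : Formula → Formula
closure φ = alls (bound φ) φ

data PA : Theory where
  ax-S0   : PA (∀' (¬' (S v0 == zer)))
  ax-Sinj : PA (∀' (∀' (S v1 == S v0 ⇒ v1 == v0)))
  ax-+0   : PA (∀' (v0 ⊕ zer == v0))
  ax-+S   : PA (∀' (∀' (v1 ⊕ S v0 == S (v1 ⊕ v0))))
  ax-*0   : PA (∀' (v0 ⊗ zer == zer))
  ax-*S   : PA (∀' (∀' (v1 ⊗ S v0 == (v1 ⊗ v0) ⊕ v1)))
  ax-ind  : (φ : Formula) → PA (closure (indBody φ))

module Submission where

-- 𝓜 U is standard arithmetic whatever U is, and every axiom of PA, including
-- the induction instances for formulas with □, is true there by induction on ℕ. The content of the lemma is that [PA]ᵢ
-- is r.e.: its axioms are listed by a primitive recursive function, which after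
-- the six fixed axioms sends w to the code of the induction axiom for the w-th
-- formula of a Cantor enumeration of all formulas. That code is assembled from
-- the Gödel codes and bounds of φ, φ(0) and φ(Sx), each a fold over φ; such a
-- fold is computed from the Cantor code of φ by a course-of-values recursion
-- that also tracks the number of binders, which substitution needs.

open import Defs
open import Level using (lift)
open import Data.Nat using (ℕ; zero; suc; _+_; _*_; _^_; _⊔_; _∸_; pred; _≤_; _<_; z≤n; s≤s; ∣_-_∣)
open import Data.Nat.Properties
open import Data.Nat.Induction using (<-rec)
open import Data.Fin using (toℕ) renaming (zero to fz; suc to fs)
open import Data.Vec using (Vec; []; _∷_; _∷ʳ_; lookup; map)
open import Data.Vec.Properties using (lookup-map)
open import Data.Vec.Relation.Unary.All using (All; []; _∷_)
open import Data.Product using (Σ; ∃; _×_; _,_; proj₁; proj₂)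
open import Data.Sum using (_⊎_; inj₁; inj₂)
open import Data.Empty using (⊥-elim)
open import Relation.Binary.PropositionalEquality
open import Relation.Binary.Definitions using (tri<; tri≈; tri>)
open import Function using (_∘_)
open import Function.Bundles using (_⇔_; mk⇔; Equivalence)

open Equivalence using (to; from)

σ₀ σ₁ : ℕ → Term
σ₀ = zer ∷ₛ var
σ₁ = S v0 ∷ₛ (var ∘ suc)

extSⁿ : ℕ → (ℕ → Term) → ℕ → Term
extSⁿ zero σ = σ
extSⁿ (suc k) σ = extS (extSⁿ k σ)

extS-cong : ∀ {σ τ : ℕ → Term} → σ ≗ τ → extS σ ≗ extS τ
extS-cong e zero = refl
extS-cong e (suc x) = cong (renT suc) (e x)

subT-cong : ∀ {σ τ : ℕ → Term} → σ ≗ τ → subT σ ≗ subT τ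
subT-cong e (var x) = e x
subT-cong e zer = refl
subT-cong e (S t) = cong S (subT-cong e t)
subT-cong e (t ⊕ u) = cong₂ _⊕_ (subT-cong e t) (subT-cong e u)
subT-cong e (t ⊗ u) = cong₂ _⊗_ (subT-cong e t) (subT-cong e u)

sub-cong : ∀ {σ τ : ℕ → Term} → σ ≗ τ → sub σ ≗ sub τ
sub-cong e (t == u) = cong₂ _==_ (subT-cong e t) (subT-cong e u)
sub-cong e ⊥' = refl
sub-cong e (φ ⇒ ψ) = cong₂ _⇒_ (sub-cong e φ) (sub-cong e ψ)
sub-cong e (φ ∧ ψ) = cong₂ _∧_ (sub-cong e φ) (sub-cong e ψ)
sub-cong e (φ ∨ ψ) = cong₂ _∨_ (sub-cong e φ) (sub-cong e ψ)
sub-cong e (∀' φ) = cong ∀' (sub-cong (extS-cong e) φ)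
sub-cong e (∃' φ) = cong ∃' (sub-cong (extS-cong e) φ)
sub-cong e (□ i φ) = cong (□ i) (sub-cong e φ)

subT-renT : ∀ (τ : ℕ → Term) ρ t → subT τ (renT ρ t) ≡ subT (τ ∘ ρ) t
subT-renT τ ρ (var x) = refl
subT-renT τ ρ zer = refl
subT-renT τ ρ (S t) = cong S (subT-renT τ ρ t)
subT-renT τ ρ (t ⊕ u) = cong₂ _⊕_ (subT-renT τ ρ t) (subT-renT τ ρ u)
subT-renT τ ρ (t ⊗ u) = cong₂ _⊗_ (subT-renT τ ρ t) (subT-renT τ ρ u)

renT-subT : ∀ ρ (τ : ℕ → Term) t → renT ρ (subT τ t) ≡ subT (renT ρ ∘ τ) t
renT-subT ρ τ (var x) = refl
renT-subT ρ τ zer = refl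
renT-subT ρ τ (S t) = cong S (renT-subT ρ τ t)
renT-subT ρ τ (t ⊕ u) = cong₂ _⊕_ (renT-subT ρ τ t) (renT-subT ρ τ u)
renT-subT ρ τ (t ⊗ u) = cong₂ _⊗_ (renT-subT ρ τ t) (renT-subT ρ τ u)

extS-subT : ∀ (τ σ : ℕ → Term) → extS (subT τ ∘ σ) ≗ subT (extS τ) ∘ extS σ
extS-subT τ σ zero = refl
extS-subT τ σ (suc x) = trans (renT-subT suc τ (σ x)) (sym (subT-renT (extS τ) suc (σ x)))

subT-subT : ∀ (τ σ : ℕ → Term) t → subT τ (subT σ t) ≡ subT (subT τ ∘ σ) t
subT-subT τ σ (var x) = refl
subT-subT τ σ zer = refl
subT-subT τ σ (S t) = cong S (subT-subT τ σ t)
subT-subT τ σ (t ⊕ u) = cong₂ _⊕_ (subT-subT τ σ t) (subT-subT τ σ u)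
subT-subT τ σ (t ⊗ u) = cong₂ _⊗_ (subT-subT τ σ t) (subT-subT τ σ u)

sub-sub : ∀ (τ σ : ℕ → Term) φ → sub τ (sub σ φ) ≡ sub (subT τ ∘ σ) φ
sub-sub τ σ (t == u) = cong₂ _==_ (subT-subT τ σ t) (subT-subT τ σ u)
sub-sub τ σ ⊥' = refl
sub-sub τ σ (φ ⇒ ψ) = cong₂ _⇒_ (sub-sub τ σ φ) (sub-sub τ σ ψ)
sub-sub τ σ (φ ∧ ψ) = cong₂ _∧_ (sub-sub τ σ φ) (sub-sub τ σ ψ)
sub-sub τ σ (φ ∨ ψ) = cong₂ _∨_ (sub-sub τ σ φ) (sub-sub τ σ ψ)
sub-sub τ σ (∀' φ) = cong ∀' (trans (sub-sub (extS τ) (extS σ) φ) (sym (sub-cong (extS-subT τ σ) φ)))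
sub-sub τ σ (∃' φ) = cong ∃' (trans (sub-sub (extS τ) (extS σ) φ) (sym (sub-cong (extS-subT τ σ) φ)))
sub-sub τ σ (□ i φ) = cong (□ i) (sub-sub τ σ φ)

-- Truth of PA in 𝓜 U

module _ (U : Family) where

  private
    eval : Term → (ℕ → ℕ) → ℕ
    eval = ⟦_⟧ (𝓜 U)

    _⊨[_] : Formula → (ℕ → ℕ) → Set₁
    φ ⊨[ s ] = Sat (𝓜 U) s φ

  eval-renT : ∀ ρ t s → eval (renT ρ t) s ≡ eval t (s ∘ ρ)
  eval-renT ρ (var x) s = refl
  eval-renT ρ zer s = refl
  eval-renT ρ (S t) s = cong suc (eval-renT ρ t s)
  eval-renT ρ (t ⊕ u) s = cong₂ _+_ (eval-renT ρ t s) (eval-renT ρ u s)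
  eval-renT ρ (t ⊗ u) s = cong₂ _*_ (eval-renT ρ t s) (eval-renT ρ u s)

  eval-subT : ∀ σ t s → eval (subT σ t) s ≡ eval t (λ x → eval (σ x) s)
  eval-subT σ (var x) s = refl
  eval-subT σ zer s = refl
  eval-subT σ (S t) s = cong suc (eval-subT σ t s)
  eval-subT σ (t ⊕ u) s = cong₂ _+_ (eval-subT σ t s) (eval-subT σ u s)
  eval-subT σ (t ⊗ u) s = cong₂ _*_ (eval-subT σ t s) (eval-subT σ u s)

  eval-cong : ∀ t {s s′} → s ≗ s′ → eval t s ≡ eval t s′
  eval-cong (var x) e = e x
  eval-cong zer e = refl
  eval-cong (S t) e = cong suc (eval-cong t e)
  eval-cong (t ⊕ u) e = cong₂ _+_ (eval-cong t e) (eval-cong u e)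
  eval-cong (t ⊗ u) e = cong₂ _*_ (eval-cong t e) (eval-cong u e)

  ∷ₛ-cong : ∀ (d : ℕ) {s s′ : ℕ → ℕ} → s ≗ s′ → (d ∷ₛ s) ≗ (d ∷ₛ s′)
  ∷ₛ-cong d e zero = refl
  ∷ₛ-cong d e (suc x) = e x

  Sat-cong : ∀ φ {s s′} → s ≗ s′ → φ ⊨[ s ] → φ ⊨[ s′ ]
  Sat-cong (t == u) e (lift p) = lift (trans (sym (eval-cong t e)) (trans p (eval-cong u e)))
  Sat-cong ⊥' e ()
  Sat-cong (φ ⇒ ψ) e f a = Sat-cong ψ e (f (Sat-cong φ (sym ∘ e) a))
  Sat-cong (φ ∧ ψ) e (a , b) = Sat-cong φ e a , Sat-cong ψ e b
  Sat-cong (φ ∨ ψ) e (inj₁ a) = inj₁ (Sat-cong φ e a)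
  Sat-cong (φ ∨ ψ) e (inj₂ b) = inj₂ (Sat-cong ψ e b)
  Sat-cong (∀' φ) e f d = Sat-cong φ (∷ₛ-cong d e) (f d)
  Sat-cong (∃' φ) e (d , a) = d , Sat-cong φ (∷ₛ-cong d e) a
  Sat-cong (□ i φ) e a = subst (U i ⊨_) (sub-cong (cong numeral ∘ e) φ) a

  -- □ is interpreted through the instance φ ^^ s, so the substitution lemma
  -- needs substitutions whose instances by numerals are numerals again.
  Numeric : (ℕ → Term) → Set
  Numeric σ = ∀ s x → subT (λ y → numeral (s y)) (σ x) ≡ numeral (eval (σ x) s)

  Numeric-extS : ∀ {σ} → Numeric σ → Numeric (extS σ)
  Numeric-extS nσ s zero = refl
  Numeric-extS {σ} nσ s (suc y) =
    trans (subT-renT (λ z → numeral (s z)) suc (σ y)) (trans (nσ (s ∘ suc) y) (cong numeral (sym (eval-renT suc (σ y) s))))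

  Numeric-σ₀ : Numeric σ₀
  Numeric-σ₀ _ zero = refl
  Numeric-σ₀ _ (suc _) = refl

  Numeric-σ₁ : Numeric σ₁
  Numeric-σ₁ _ zero = refl
  Numeric-σ₁ _ (suc _) = refl

  eval-extS : ∀ σ d s → (λ x → eval (extS σ x) (d ∷ₛ s)) ≗ (d ∷ₛ λ y → eval (σ y) s)
  eval-extS σ d s zero = refl
  eval-extS σ d s (suc y) = eval-renT suc (σ y) (d ∷ₛ s)

  Sat-sub : ∀ φ σ s → Numeric σ → sub σ φ ⊨[ s ] ⇔ φ ⊨[ (λ x → eval (σ x) s) ]
  Sat-sub (t == u) σ s nσ =
    mk⇔ (λ { (lift p) → lift (trans (sym (eval-subT σ t s)) (trans p (eval-subT σ u s))) })
        (λ { (lift p) → lift (trans (eval-subT σ t s) (trans p (sym (eval-subT σ u s)))) })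
  Sat-sub ⊥' σ s nσ = mk⇔ (λ a → a) (λ a → a)
  Sat-sub (φ ⇒ ψ) σ s nσ =
    mk⇔ (λ f a → to (Sat-sub ψ σ s nσ) (f (from (Sat-sub φ σ s nσ) a)))
        (λ f a → from (Sat-sub ψ σ s nσ) (f (to (Sat-sub φ σ s nσ) a)))
  Sat-sub (φ ∧ ψ) σ s nσ =
    mk⇔ (λ { (a , b) → to (Sat-sub φ σ s nσ) a , to (Sat-sub ψ σ s nσ) b })
        (λ { (a , b) → from (Sat-sub φ σ s nσ) a , from (Sat-sub ψ σ s nσ) b })
  Sat-sub (φ ∨ ψ) σ s nσ =
    mk⇔ (λ { (inj₁ a) → inj₁ (to (Sat-sub φ σ s nσ) a) ; (inj₂ b) → inj₂ (to (Sat-sub ψ σ s nσ) b) })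
        (λ { (inj₁ a) → inj₁ (from (Sat-sub φ σ s nσ) a) ; (inj₂ b) → inj₂ (from (Sat-sub ψ σ s nσ) b) })
  Sat-sub (∀' φ) σ s nσ =
    mk⇔ (λ f d → Sat-cong φ (eval-extS σ d s) (to (Sat-sub φ (extS σ) (d ∷ₛ s) (Numeric-extS nσ)) (f d)))
        (λ f d → from (Sat-sub φ (extS σ) (d ∷ₛ s) (Numeric-extS nσ)) (Sat-cong φ (sym ∘ eval-extS σ d s) (f d)))
  Sat-sub (∃' φ) σ s nσ =
    mk⇔ (λ { (d , a) → d , Sat-cong φ (eval-extS σ d s) (to (Sat-sub φ (extS σ) (d ∷ₛ s) (Numeric-extS nσ)) a) })
        (λ { (d , a) → d , from (Sat-sub φ (extS σ) (d ∷ₛ s) (Numeric-extS nσ)) (Sat-cong φ (sym ∘ eval-extS σ d s) a) })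
  Sat-sub (□ i φ) σ s nσ = mk⇔ (subst (U i ⊨_) numerals) (subst (U i ⊨_) (sym numerals))
    where
    numerals : sub (λ x → numeral (s x)) (sub σ φ) ≡ sub (λ x → numeral (eval (σ x) s)) φ
    numerals = trans (sub-sub (λ x → numeral (s x)) σ φ) (sub-cong (nσ s) φ)

  Sat-alls : ∀ n φ → (∀ s → φ ⊨[ s ]) → ∀ s → alls n φ ⊨[ s ]
  Sat-alls zero φ ⊨φ s = ⊨φ s
  Sat-alls (suc n) φ ⊨φ s d = Sat-alls n φ ⊨φ (d ∷ₛ s)

  Sat-indBody : ∀ φ s → indBody φ ⊨[ s ]
  Sat-indBody φ s (base , step) = induction
    where
    induction : ∀ d → φ ⊨[ d ∷ₛ s ]
    induction zero = Sat-cong φ (λ { zero → refl ; (suc _) → refl }) (to (Sat-sub φ σ₀ s Numeric-σ₀) base)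
    induction (suc d) =
      Sat-cong φ (λ { zero → refl ; (suc _) → refl }) (to (Sat-sub φ σ₁ (d ∷ₛ s) Numeric-σ₁) (step d (induction d)))

  𝓜-models-PA : ∀ {φ} → PA φ → Models (𝓜 U) φ
  𝓜-models-PA ax-S0 s d (lift ())
  𝓜-models-PA ax-Sinj s d e (lift p) = lift (suc-injective p)
  𝓜-models-PA ax-+0 s d = lift (+-identityʳ d)
  𝓜-models-PA ax-+S s d e = lift (+-suc d e)
  𝓜-models-PA ax-*0 s d = lift (*-zeroʳ d)
  𝓜-models-PA ax-*S s d e = lift (trans (*-suc d e) (+-comm d (d * e)))
  𝓜-models-PA (ax-ind φ) = Sat-alls (bound (indBody φ)) (indBody φ) (Sat-indBody φ)

-- Primitive recursive functions

Fn : ℕ → Set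
Fn n = Vec ℕ n → ℕ

PrimRec : ∀ {n} → Fn n → Set
PrimRec {n} f = Σ (PR n) λ c → evalPR c ≗ f

PrimRec₁ : (ℕ → ℕ) → Set
PrimRec₁ f = PrimRec {1} λ xs → f (lookup xs fz)

PrimRec₂ : (ℕ → ℕ → ℕ) → Set
PrimRec₂ f = PrimRec {2} λ xs → f (lookup xs fz) (lookup xs (fs fz))

PrimRec₃ : (ℕ → ℕ → ℕ → ℕ) → Set
PrimRec₃ f = PrimRec {3} λ xs → f (lookup xs fz) (lookup xs (fs fz)) (lookup xs (fs (fs fz)))

PrimRec-resp : ∀ {n} {f g : Fn n} → f ≗ g → PrimRec f → PrimRec g
PrimRec-resp f≗g (c , c≗f) = c , λ xs → trans (c≗f xs) (f≗g xs)

pr-zero : ∀ {n} → PrimRec {n} λ _ → 0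
pr-zero = Z , λ _ → refl

pr-suc : PrimRec₁ suc
pr-suc = Succ , λ { (x ∷ []) → refl }

x₀ : ∀ {n} → PrimRec {suc n} λ xs → lookup xs fz
x₀ = Proj fz , λ _ → refl

x₁ : ∀ {n} → PrimRec {suc (suc n)} λ xs → lookup xs (fs fz)
x₁ = Proj (fs fz) , λ _ → refl

x₂ : ∀ {n} → PrimRec {suc (suc (suc n))} λ xs → lookup xs (fs (fs fz))
x₂ = Proj (fs (fs fz)) , λ _ → refl

x₃ : ∀ {n} → PrimRec {suc (suc (suc (suc n)))} λ xs → lookup xs (fs (fs (fs fz)))
x₃ = Proj (fs (fs (fs fz))) , λ _ → refl

module _ {n : ℕ} where

  pr-comp₁ : {f : ℕ → ℕ} {g : Fn n} → PrimRec₁ f → PrimRec g → PrimRec (f ∘ g)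
  pr-comp₁ {f} (c , c≗f) (d , d≗g) = Comp c (d ∷ []) , λ xs → trans (c≗f _) (cong f (d≗g xs))

  pr-comp₂ : {f : ℕ → ℕ → ℕ} {g h : Fn n} → PrimRec₂ f → PrimRec g → PrimRec h →
             PrimRec λ xs → f (g xs) (h xs)
  pr-comp₂ {f} (c , c≗f) (d , d≗g) (e , e≗h) =
    Comp c (d ∷ e ∷ []) , λ xs → trans (c≗f _) (cong₂ f (d≗g xs) (e≗h xs))

  pr-comp₃ : {f : ℕ → ℕ → ℕ → ℕ} {g h k : Fn n} → PrimRec₃ f → PrimRec g → PrimRec h → PrimRec k →
             PrimRec λ xs → f (g xs) (h xs) (k xs)
  pr-comp₃ {f} (c , c≗f) (d , d≗g) (e , e≗h) (o , o≗k) =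
    Comp c (d ∷ e ∷ o ∷ []) , λ xs →
      trans (c≗f _) (trans (cong₂ (λ a b → f a b _) (d≗g xs) (e≗h xs)) (cong (f _ _) (o≗k xs)))

primRec : ∀ {n} → Fn n → Fn (suc (suc n)) → Fn (suc n)
primRec g h (zero ∷ xs) = g xs
primRec g h (suc k ∷ xs) = h (k ∷ primRec g h (k ∷ xs) ∷ xs)

pr-rec : ∀ {n} {g : Fn n} {h : Fn (suc (suc n))} → PrimRec g → PrimRec h → PrimRec (primRec g h)
pr-rec {g = g} {h} (c , c≗g) (d , d≗h) = Rec c d , evalPR-Rec
  where
  evalPR-Rec : ∀ xs → evalPR (Rec c d) xs ≡ primRec g h xs
  evalPR-Rec (zero ∷ xs) = c≗g xs
  evalPR-Rec (suc k ∷ xs) rewrite evalPR-Rec (k ∷ xs) = d≗h _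

pr-const : ∀ {n} (c : ℕ) → PrimRec {n} λ _ → c
pr-const zero = pr-zero
pr-const (suc c) = pr-comp₁ {f = suc} pr-suc (pr-const c)

pr-rec₁ : {f : ℕ → ℕ} {h : ℕ → ℕ → ℕ} → PrimRec₂ h → (∀ x → f (suc x) ≡ h x (f x)) → PrimRec₁ f
pr-rec₁ {f} {h} ph f-suc = PrimRec-resp unfold (pr-rec (pr-const (f 0)) ph)
  where
  unfold : (xs : Vec ℕ 1) → primRec (λ _ → f 0) (λ ys → h (lookup ys fz) (lookup ys (fs fz))) xs ≡ f (lookup xs fz)
  unfold (zero ∷ []) = refl
  unfold (suc x ∷ []) = trans (cong (h x) (unfold (x ∷ []))) (sym (f-suc x))

pr-rec₂ : {f : ℕ → ℕ → ℕ} {g : ℕ → ℕ} {h : ℕ → ℕ → ℕ → ℕ} → PrimRec₁ g → PrimRec₃ h →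
          (∀ y → f 0 y ≡ g y) → (∀ x y → f (suc x) y ≡ h x (f x y) y) → PrimRec₂ f
pr-rec₂ {f} {g} {h} pg ph f-zero f-suc = PrimRec-resp unfold (pr-rec pg ph)
  where
  unfold : (xs : Vec ℕ 2) →
           primRec (λ ys → g (lookup ys fz)) (λ ys → h (lookup ys fz) (lookup ys (fs fz)) (lookup ys (fs (fs fz)))) xs
           ≡ f (lookup xs fz) (lookup xs (fs fz))
  unfold (zero ∷ y ∷ []) = sym (f-zero y)
  unfold (suc x ∷ y ∷ []) = trans (cong (λ a → h x a y) (unfold (x ∷ y ∷ []))) (sym (f-suc x y))

pr-+ : PrimRec₂ _+_
pr-+ = pr-rec₂ {f = _+_} {h = λ _ a _ → suc a} x₀ (pr-comp₁ {f = suc} pr-suc x₁) (λ _ → refl) (λ _ _ → refl)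

pr-* : PrimRec₂ _*_
pr-* = pr-rec₂ {f = _*_} {h = λ _ a y → y + a} pr-zero (pr-comp₂ {f = _+_} pr-+ x₂ x₁) (λ _ → refl) (λ _ _ → refl)

pr-pred : PrimRec₁ pred
pr-pred = PrimRec-resp (λ { (zero ∷ []) → refl ; (suc _ ∷ []) → refl }) (pr-rec pr-zero x₀)

pr-∸ : PrimRec₂ _∸_
pr-∸ = pr-comp₂ {f = λ y x → x ∸ y} ∸-flipped x₁ x₀
  where
  ∸-flipped : PrimRec₂ λ y x → x ∸ y
  ∸-flipped = pr-rec₂ {f = λ y x → x ∸ y} {h = λ _ a _ → pred a} x₀ (pr-comp₁ {f = pred} pr-pred x₁)
    (λ _ → refl) (λ y x → sym (pred[m∸n]≡m∸[1+n] x y))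

pr-2^ : PrimRec₁ (2 ^_)
pr-2^ = pr-rec₁ {f = 2 ^_} {h = λ _ a → 2 * a} (pr-comp₂ {f = _*_} pr-* (pr-const 2) x₁) (λ _ → refl)

ifz : ℕ → ℕ → ℕ → ℕ
ifz zero a b = a
ifz (suc _) a b = b

pr-ifz : PrimRec₃ ifz
pr-ifz = PrimRec-resp (λ { (zero ∷ _) → refl ; (suc _ ∷ _) → refl }) (pr-rec x₀ x₃)

∣m-n∣≡[m∸n]+[n∸m] : ∀ m n → ∣ m - n ∣ ≡ (m ∸ n) + (n ∸ m)
∣m-n∣≡[m∸n]+[n∸m] zero zero = refl
∣m-n∣≡[m∸n]+[n∸m] zero (suc n) = refl
∣m-n∣≡[m∸n]+[n∸m] (suc m) zero = sym (+-identityʳ (suc m))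
∣m-n∣≡[m∸n]+[n∸m] (suc m) (suc n) = ∣m-n∣≡[m∸n]+[n∸m] m n

m⊔n≡m+[n∸m] : ∀ m n → m ⊔ n ≡ m + (n ∸ m)
m⊔n≡m+[n∸m] zero n = refl
m⊔n≡m+[n∸m] (suc m) zero = cong suc (sym (+-identityʳ m))
m⊔n≡m+[n∸m] (suc m) (suc n) = cong suc (m⊔n≡m+[n∸m] m n)

module _ {n : ℕ} {f g : Fn n} where
  infixl 6 _+ᵖ_ _∸ᵖ_
  infixl 7 _*ᵖ_

  _+ᵖ_ : PrimRec f → PrimRec g → PrimRec λ xs → f xs + g xs
  _+ᵖ_ = pr-comp₂ {f = _+_} pr-+

  _*ᵖ_ : PrimRec f → PrimRec g → PrimRec λ xs → f xs * g xs
  _*ᵖ_ = pr-comp₂ {f = _*_} pr-*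

  _∸ᵖ_ : PrimRec f → PrimRec g → PrimRec λ xs → f xs ∸ g xs
  _∸ᵖ_ = pr-comp₂ {f = _∸_} pr-∸

module _ {n : ℕ} {f g : Fn n} where
  infixl 6 _⊔ᵖ_

  _⊔ᵖ_ : PrimRec f → PrimRec g → PrimRec λ xs → f xs ⊔ g xs
  p ⊔ᵖ q = PrimRec-resp (λ xs → sym (m⊔n≡m+[n∸m] (f xs) (g xs))) (p +ᵖ (q ∸ᵖ p))

  ∣_-_∣ᵖ : PrimRec f → PrimRec g → PrimRec λ xs → ∣ f xs - g xs ∣
  ∣ p - q ∣ᵖ = PrimRec-resp (λ xs → sym (∣m-n∣≡[m∸n]+[n∸m] (f xs) (g xs))) ((p ∸ᵖ q) +ᵖ (q ∸ᵖ p))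

  pairᵖ : PrimRec f → PrimRec g → PrimRec λ xs → pair (f xs) (g xs)
  pairᵖ p q = pr-comp₁ {f = 2 ^_} pr-2^ p *ᵖ (pr-const 2 *ᵖ q +ᵖ pr-const 1)

select : ∀ {m} → ℕ → Vec ℕ (suc m) → ℕ
select _ (v ∷ []) = v
select zero (v ∷ _ ∷ _) = v
select (suc t) (_ ∷ vs@(_ ∷ _)) = select t vs

select-ifz : ∀ {m} t v (vs : Vec ℕ (suc m)) → select t (v ∷ vs) ≡ ifz t v (select (pred t) vs)
select-ifz zero v (_ ∷ _) = refl
select-ifz (suc t) v (_ ∷ _) = refl

selectᵖ : ∀ {n m} {t : Fn n} {gs : Vec (Fn n) (suc m)} → PrimRec t → All PrimRec gs →
          PrimRec λ xs → select (t xs) (map (λ g → g xs) gs)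
selectᵖ pt (pg ∷ []) = pg
selectᵖ {t = t} {g ∷ gs@(_ ∷ _)} pt (pg ∷ pgs@(_ ∷ _)) =
  PrimRec-resp (λ xs → sym (select-ifz (t xs) (g xs) (map (λ h → h xs) gs)))
    (pr-comp₃ {f = ifz} pr-ifz pt pg (selectᵖ (pr-comp₁ {f = pred} pr-pred pt) pgs))

-- Cantor pairing

triangle : ℕ → ℕ
triangle zero = 0
triangle (suc n) = triangle n + suc n

triangle-mono-≤ : ∀ {a b} → a ≤ b → triangle a ≤ triangle b
triangle-mono-≤ z≤n = z≤n
triangle-mono-≤ (s≤s a≤b) = +-mono-≤ (triangle-mono-≤ a≤b) (s≤s a≤b)

n≤triangle : ∀ n → n ≤ triangle n
n≤triangle zero = z≤n
n≤triangle (suc n) = m≤n+m (suc n) (triangle n)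

OnDiagonal : ℕ → ℕ → Set
OnDiagonal m d = Σ ℕ λ r → m ≡ triangle d + r × r ≤ d

-- The point after the last point triangle d + d of diagonal d starts diagonal suc d.
diagonalStep : ℕ → ℕ → ℕ
diagonalStep m d = ifz ∣ m ∸ triangle d - d ∣ (suc d) d

diagonal : ℕ → ℕ
diagonal zero = 0
diagonal (suc m) = diagonalStep m (diagonal m)

diagonalStep-onDiagonal : ∀ {m d} → OnDiagonal m d → OnDiagonal (suc m) (diagonalStep m d)
diagonalStep-onDiagonal {d = d} (r , refl , r≤d) rewrite m+n∸m≡n (triangle d) r with ∣ r - d ∣ in r-d
... | zero rewrite ∣m-n∣≡0⇒m≡n {r} r-d = 0 , trans (sym (+-suc (triangle d) d)) (sym (+-identityʳ _)) , z≤n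
... | suc _ = suc r , sym (+-suc (triangle d) r) , ≤∧≢⇒< r≤d r≢d
  where
  r≢d : r ≢ d
  r≢d refl with trans (sym r-d) (∣n-n∣≡0 r)
  ... | ()

diagonal-onDiagonal : ∀ m → OnDiagonal m (diagonal m)
diagonal-onDiagonal zero = 0 , refl , z≤n
diagonal-onDiagonal (suc m) = diagonalStep-onDiagonal (diagonal-onDiagonal m)

triangle+offset-< : ∀ {d e r s} → d < e → r ≤ d → triangle d + r < triangle e + s
triangle+offset-< {d} {e} {r} {s} d<e r≤d =
  <-≤-trans (+-monoʳ-< (triangle d) (s≤s r≤d)) (≤-trans (triangle-mono-≤ d<e) (m≤m+n (triangle e) s))

onDiagonal-unique : ∀ {m d e} → OnDiagonal m d → OnDiagonal m e → d ≡ e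
onDiagonal-unique {d = d} {e} (r , refl , r≤d) (s , eq , s≤e) with <-cmp d e
... | tri< d<e _ _ = ⊥-elim (<-irrefl eq (triangle+offset-< d<e r≤d))
... | tri≈ _ d≡e _ = d≡e
... | tri> _ _ e<d = ⊥-elim (<-irrefl (sym eq) (triangle+offset-< e<d s≤e))

pr-triangle : PrimRec₁ triangle
pr-triangle = pr-rec₁ {f = triangle} {h = λ n a → a + suc n} (x₁ +ᵖ pr-comp₁ {f = suc} pr-suc x₀) (λ _ → refl)

pr-diagonal : PrimRec₁ diagonal
pr-diagonal = pr-rec₁ {f = diagonal} {h = diagonalStep}
  (pr-comp₃ {f = ifz} pr-ifz ∣ x₀ ∸ᵖ pr-comp₁ {f = triangle} pr-triangle x₁ - x₁ ∣ᵖ (pr-comp₁ {f = suc} pr-suc x₁) x₁)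
  (λ _ → refl)

-- Opaque: unfolding these functions inside the large expressions built from
-- them below makes conversion checking prohibitively expensive.
opaque
  cantor : ℕ → ℕ → ℕ
  cantor a b = triangle (a + b) + b

  cantor₂ : ℕ → ℕ
  cantor₂ m = m ∸ triangle (diagonal m)

  cantor₁ : ℕ → ℕ
  cantor₁ m = diagonal m ∸ cantor₂ m

  diagonal-cantor : ∀ a b → diagonal (cantor a b) ≡ a + b
  diagonal-cantor a b = onDiagonal-unique (diagonal-onDiagonal (cantor a b)) (b , refl , m≤n+m b a)

  cantor₂-cantor : ∀ a b → cantor₂ (cantor a b) ≡ b
  cantor₂-cantor a b rewrite diagonal-cantor a b = m+n∸m≡n (triangle (a + b)) b

  cantor₁-cantor : ∀ a b → cantor₁ (cantor a b) ≡ a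
  cantor₁-cantor a b rewrite cantor₂-cantor a b | diagonal-cantor a b = m+n∸n≡m a b

  cantor₂-≤ : ∀ m → cantor₂ m ≤ m
  cantor₂-≤ m = m∸n≤m m (triangle (diagonal m))

  cantor₁-≤ : ∀ m → cantor₁ m ≤ m
  cantor₁-≤ m with diagonal-onDiagonal m
  ... | r , m≡ , _ = begin
    diagonal m ∸ cantor₂ m     ≤⟨ m∸n≤m (diagonal m) (cantor₂ m) ⟩
    diagonal m                 ≤⟨ n≤triangle (diagonal m) ⟩
    triangle (diagonal m)      ≤⟨ m≤m+n _ r ⟩
    triangle (diagonal m) + r  ≡⟨ sym m≡ ⟩
    m                          ∎
    where open ≤-Reasoning

  cantor-monoʳ-< : ∀ a {b c} → b < c → cantor a b < cantor a c
  cantor-monoʳ-< a b<c = +-mono-≤-< (triangle-mono-≤ (+-monoʳ-≤ a (<⇒≤ b<c))) b<c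

  cantor-suc-< : ∀ a {b c} → b < c → cantor (suc a) b < cantor a c
  cantor-suc-< a {b} b<c = +-mono-≤-< (triangle-mono-≤ (≤-trans (≤-reflexive (sym (+-suc a b))) (+-monoʳ-≤ a b<c))) b<c

  cantorᵖ : ∀ {n} {f g : Fn n} → PrimRec f → PrimRec g → PrimRec λ xs → cantor (f xs) (g xs)
  cantorᵖ p q = pr-comp₁ {f = triangle} pr-triangle (p +ᵖ q) +ᵖ q

  cantor₂ᵖ : ∀ {n} {f : Fn n} → PrimRec f → PrimRec λ xs → cantor₂ (f xs)
  cantor₂ᵖ p = p ∸ᵖ pr-comp₁ {f = triangle} pr-triangle (pr-comp₁ {f = diagonal} pr-diagonal p)

  cantor₁ᵖ : ∀ {n} {f : Fn n} → PrimRec f → PrimRec λ xs → cantor₁ (f xs)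
  cantor₁ᵖ p = pr-comp₁ {f = diagonal} pr-diagonal p ∸ᵖ cantor₂ᵖ p

-- history step p n stacks the values at n - 1, …, 0 by repeated pairing,
-- the most recent one on top; entry n h j reads off the value at j.
history : (ℕ → ℕ → ℕ → ℕ) → ℕ → ℕ → ℕ
history step p zero = 0
history step p (suc n) = cantor (step p n (history step p n)) (history step p n)

courseOfValues : (ℕ → ℕ → ℕ → ℕ) → ℕ → ℕ → ℕ
courseOfValues step p n = step p n (history step p n)

pop : ℕ → ℕ → ℕ
pop zero s = s
pop (suc k) s = cantor₂ (pop k s)

pop-suc : ∀ k s → pop (suc k) s ≡ pop k (cantor₂ s)
pop-suc zero s = refl
pop-suc (suc k) s = cong cantor₂ (pop-suc k s)

entry : ℕ → ℕ → ℕ → ℕ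
entry n h j = cantor₁ (pop (n ∸ suc j) h)

entry-history : ∀ step p {n j} → j < n → entry n (history step p n) j ≡ courseOfValues step p j
entry-history step p {suc n} {j} j<1+n with m<1+n⇒m<n∨m≡n j<1+n
... | inj₂ refl rewrite n∸n≡0 j = cantor₁-cantor _ _
... | inj₁ j<n rewrite +-∸-assoc 1 j<n | pop-suc (n ∸ suc j) (history step p (suc n))
                     | cantor₂-cantor (step p n (history step p n)) (history step p n)
  = entry-history step p j<n

pr-pop : PrimRec₂ pop
pr-pop = pr-rec₂ {f = pop} {h = λ _ s _ → cantor₂ s} x₀ (cantor₂ᵖ x₁) (λ _ → refl) (λ _ _ → refl)

entryᵖ : ∀ {n} {f g h : Fn n} → PrimRec f → PrimRec g → PrimRec h → PrimRec λ xs → entry (f xs) (g xs) (h xs)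
entryᵖ p q r = cantor₁ᵖ (pr-comp₂ {f = pop} pr-pop (p ∸ᵖ pr-comp₁ {f = suc} pr-suc r) q)

pr-courseOfValues : ∀ {step} → PrimRec₃ step → PrimRec₂ (courseOfValues step)
pr-courseOfValues {step} pr-step = pr-comp₃ {f = step} pr-step x₀ x₁ (pr-comp₂ {f = λ n p → history step p n} pr-history x₁ x₀)
  where
  pr-history : PrimRec₂ λ n p → history step p n
  pr-history = pr-rec₂ {f = λ n p → history step p n} {h = λ n s p → cantor (step p n s) s} pr-zero
    (cantorᵖ (pr-comp₃ {f = step} pr-step x₂ x₀ x₁) x₁) (λ _ → refl) (λ _ _ → refl)

-- Cantor codes of terms and formulas

-- The code suc m of a compound expression stores the constructor tag
-- cantor₁ m and the payload cantor₂ m; two immediate subexpressions are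
-- stored as the components left m and right m of the payload.
left right : ℕ → ℕ
left m = cantor₁ (cantor₂ m)
right m = cantor₂ (cantor₂ m)

node : ℕ → ℕ → ℕ
node tag payload = suc (cantor tag payload)

payload-< : ∀ m → cantor₂ m < suc m
payload-< m = s≤s (cantor₂-≤ m)

left-< : ∀ m → left m < suc m
left-< m = s≤s (≤-trans (cantor₁-≤ (cantor₂ m)) (cantor₂-≤ m))

right-< : ∀ m → right m < suc m
right-< m = s≤s (≤-trans (cantor₂-≤ (cantor₂ m)) (cantor₂-≤ m))

data TermCode : ℕ → Term → Set where
  code-0   : TermCode 0 zer
  code-var : ∀ {m} → cantor₁ m ≡ 0 → TermCode (suc m) (var (cantor₂ m))
  code-zer : ∀ {m} → cantor₁ m ≡ 1 → TermCode (suc m) zer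
  code-S   : ∀ {m t} → cantor₁ m ≡ 2 → TermCode (cantor₂ m) t → TermCode (suc m) (S t)
  code-⊕   : ∀ {m t u} → cantor₁ m ≡ 3 → TermCode (left m) t → TermCode (right m) u → TermCode (suc m) (t ⊕ u)
  code-⊗   : ∀ {m t u x} → cantor₁ m ≡ 4 + x → TermCode (left m) t → TermCode (right m) u → TermCode (suc m) (t ⊗ u)

data FormulaCode : ℕ → Formula → Set where
  code-0  : FormulaCode 0 ⊥'
  code-== : ∀ {m t u} → cantor₁ m ≡ 0 → TermCode (left m) t → TermCode (right m) u → FormulaCode (suc m) (t == u)
  code-⊥  : ∀ {m} → cantor₁ m ≡ 1 → FormulaCode (suc m) ⊥'
  code-⇒  : ∀ {m φ ψ} → cantor₁ m ≡ 2 → FormulaCode (left m) φ → FormulaCode (right m) ψ → FormulaCode (suc m) (φ ⇒ ψ)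
  code-∧  : ∀ {m φ ψ} → cantor₁ m ≡ 3 → FormulaCode (left m) φ → FormulaCode (right m) ψ → FormulaCode (suc m) (φ ∧ ψ)
  code-∨  : ∀ {m φ ψ} → cantor₁ m ≡ 4 → FormulaCode (left m) φ → FormulaCode (right m) ψ → FormulaCode (suc m) (φ ∨ ψ)
  code-∀  : ∀ {m φ} → cantor₁ m ≡ 5 → FormulaCode (cantor₂ m) φ → FormulaCode (suc m) (∀' φ)
  code-∃  : ∀ {m φ} → cantor₁ m ≡ 6 → FormulaCode (cantor₂ m) φ → FormulaCode (suc m) (∃' φ)
  code-□  : ∀ {m φ x} → cantor₁ m ≡ 7 + x → FormulaCode (right m) φ → FormulaCode (suc m) (□ (left m) φ)

module _ {A : Set} (R : ℕ → A → Set) {x : A} where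

  at-payload : ∀ tag {a} → R a x → R (cantor₂ (cantor tag a)) x
  at-payload tag {a} = subst (λ k → R k x) (sym (cantor₂-cantor tag a))

  at-left : ∀ tag {a} b → R a x → R (left (cantor tag (cantor a b))) x
  at-left tag {a} b = subst (λ k → R k x) (sym (trans (cong cantor₁ (cantor₂-cantor tag (cantor a b))) (cantor₁-cantor a b)))

  at-right : ∀ tag a {b} → R b x → R (right (cantor tag (cantor a b))) x
  at-right tag a {b} = subst (λ k → R k x) (sym (trans (cong cantor₂ (cantor₂-cantor tag (cantor a b))) (cantor₂-cantor a b)))

encodeT : Term → ℕ
encodeT (var x) = node 0 x
encodeT zer = node 1 0
encodeT (S t) = node 2 (encodeT t)
encodeT (t ⊕ u) = node 3 (cantor (encodeT t) (encodeT u))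
encodeT (t ⊗ u) = node 4 (cantor (encodeT t) (encodeT u))

encodeT-code : ∀ t → TermCode (encodeT t) t
encodeT-code (var x) =
  subst (λ y → TermCode (node 0 x) (var y)) (cantor₂-cantor 0 x) (code-var (cantor₁-cantor 0 x))
encodeT-code zer = code-zer (cantor₁-cantor 1 0)
encodeT-code (S t) = code-S (cantor₁-cantor 2 (encodeT t)) (at-payload TermCode 2 (encodeT-code t))
encodeT-code (t ⊕ u) =
  code-⊕ (cantor₁-cantor 3 (cantor (encodeT t) (encodeT u)))
         (at-left TermCode 3 (encodeT u) (encodeT-code t)) (at-right TermCode 3 (encodeT t) (encodeT-code u))
encodeT-code (t ⊗ u) =
  code-⊗ (cantor₁-cantor 4 (cantor (encodeT t) (encodeT u)))
         (at-left TermCode 4 (encodeT u) (encodeT-code t)) (at-right TermCode 4 (encodeT t) (encodeT-code u))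

encodeF : Formula → ℕ
encodeF (t == u) = node 0 (cantor (encodeT t) (encodeT u))
encodeF ⊥' = node 1 0
encodeF (φ ⇒ ψ) = node 2 (cantor (encodeF φ) (encodeF ψ))
encodeF (φ ∧ ψ) = node 3 (cantor (encodeF φ) (encodeF ψ))
encodeF (φ ∨ ψ) = node 4 (cantor (encodeF φ) (encodeF ψ))
encodeF (∀' φ) = node 5 (encodeF φ)
encodeF (∃' φ) = node 6 (encodeF φ)
encodeF (□ i φ) = node 7 (cantor i (encodeF φ))

encodeF-code : ∀ φ → FormulaCode (encodeF φ) φ
encodeF-code (t == u) =
  code-== (cantor₁-cantor 0 (cantor (encodeT t) (encodeT u)))
          (at-left TermCode 0 (encodeT u) (encodeT-code t)) (at-right TermCode 0 (encodeT t) (encodeT-code u))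
encodeF-code ⊥' = code-⊥ (cantor₁-cantor 1 0)
encodeF-code (φ ⇒ ψ) =
  code-⇒ (cantor₁-cantor 2 (cantor (encodeF φ) (encodeF ψ)))
         (at-left FormulaCode 2 (encodeF ψ) (encodeF-code φ)) (at-right FormulaCode 2 (encodeF φ) (encodeF-code ψ))
encodeF-code (φ ∧ ψ) =
  code-∧ (cantor₁-cantor 3 (cantor (encodeF φ) (encodeF ψ)))
         (at-left FormulaCode 3 (encodeF ψ) (encodeF-code φ)) (at-right FormulaCode 3 (encodeF φ) (encodeF-code ψ))
encodeF-code (φ ∨ ψ) =
  code-∨ (cantor₁-cantor 4 (cantor (encodeF φ) (encodeF ψ)))
         (at-left FormulaCode 4 (encodeF ψ) (encodeF-code φ)) (at-right FormulaCode 4 (encodeF φ) (encodeF-code ψ))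
encodeF-code (∀' φ) = code-∀ (cantor₁-cantor 5 (encodeF φ)) (at-payload FormulaCode 5 (encodeF-code φ))
encodeF-code (∃' φ) = code-∃ (cantor₁-cantor 6 (encodeF φ)) (at-payload FormulaCode 6 (encodeF-code φ))
encodeF-code (□ i φ) =
  subst (λ j → FormulaCode (encodeF (□ i φ)) (□ j φ))
        (trans (cong cantor₁ (cantor₂-cantor 7 (cantor i (encodeF φ)))) (cantor₁-cantor i (encodeF φ)))
        (code-□ (cantor₁-cantor 7 (cantor i (encodeF φ))) (at-right FormulaCode 7 i (encodeF-code φ)))

termCode-total : ∀ m → Σ Term (TermCode m)
termCode-total = <-rec _ decode
  where
  decode : ∀ m → (∀ {k} → k < m → Σ Term (TermCode k)) → Σ Term (TermCode m)
  decode zero _ = zer , code-0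
  decode (suc m) rec with cantor₁ m in tag
  ... | 0 = var _ , code-var tag
  ... | 1 = zer , code-zer tag
  ... | 2 = let t , c = rec (payload-< m) in S t , code-S tag c
  ... | 3 = let t , c = rec (left-< m) ; u , d = rec (right-< m) in t ⊕ u , code-⊕ tag c d
  ... | suc (suc (suc (suc _))) = let t , c = rec (left-< m) ; u , d = rec (right-< m) in t ⊗ u , code-⊗ tag c d

formulaCode-total : ∀ m → Σ Formula (FormulaCode m)
formulaCode-total = <-rec _ decode
  where
  decode : ∀ m → (∀ {k} → k < m → Σ Formula (FormulaCode k)) → Σ Formula (FormulaCode m)
  decode zero _ = ⊥' , code-0
  decode (suc m) rec with cantor₁ m in tag
  ... | 0 = let t , c = termCode-total (left m) ; u , d = termCode-total (right m) in t == u , code-== tag c d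
  ... | 1 = ⊥' , code-⊥ tag
  ... | 2 = let φ , c = rec (left-< m) ; ψ , d = rec (right-< m) in φ ⇒ ψ , code-⇒ tag c d
  ... | 3 = let φ , c = rec (left-< m) ; ψ , d = rec (right-< m) in φ ∧ ψ , code-∧ tag c d
  ... | 4 = let φ , c = rec (left-< m) ; ψ , d = rec (right-< m) in φ ∨ ψ , code-∨ tag c d
  ... | 5 = let φ , c = rec (payload-< m) in ∀' φ , code-∀ tag c
  ... | 6 = let φ , c = rec (payload-< m) in ∃' φ , code-∃ tag c
  ... | suc (suc (suc (suc (suc (suc (suc _)))))) = let φ , c = rec (right-< m) in □ (left m) φ , code-□ tag c

-- Folds over coded formulas

record Algebra : Set where
  field
    on-zer : ℕ
    on-S : ℕ → ℕ
    on-⊕ on-⊗ : ℕ → ℕ → ℕ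
    on-== : ℕ → ℕ → ℕ
    on-⊥ : ℕ
    on-⇒ on-∧ on-∨ : ℕ → ℕ → ℕ
    on-∀ on-∃ : ℕ → ℕ
    on-□ : ℕ → ℕ → ℕ

record PrimRecAlgebra (A : Algebra) : Set where
  open Algebra A
  field
    pr-S : PrimRec₁ on-S
    pr-⊕ : PrimRec₂ on-⊕
    pr-⊗ : PrimRec₂ on-⊗
    pr-== : PrimRec₂ on-==
    pr-⇒ : PrimRec₂ on-⇒
    pr-∧ : PrimRec₂ on-∧
    pr-∨ : PrimRec₂ on-∨
    pr-∀ : PrimRec₁ on-∀
    pr-∃ : PrimRec₁ on-∃
    pr-□ : PrimRec₂ on-□

module _ (A : Algebra) where
  open Algebra A

  foldT : (ℕ → ℕ) → Term → ℕ
  foldT w (var x) = w x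
  foldT w zer = on-zer
  foldT w (S t) = on-S (foldT w t)
  foldT w (t ⊕ u) = on-⊕ (foldT w t) (foldT w u)
  foldT w (t ⊗ u) = on-⊗ (foldT w t) (foldT w u)

  -- v k x is the value of the variable x under k binders.
  foldF : (ℕ → ℕ → ℕ) → ℕ → Formula → ℕ
  foldF v k (t == u) = on-== (foldT (v k) t) (foldT (v k) u)
  foldF v k ⊥' = on-⊥
  foldF v k (φ ⇒ ψ) = on-⇒ (foldF v k φ) (foldF v k ψ)
  foldF v k (φ ∧ ψ) = on-∧ (foldF v k φ) (foldF v k ψ)
  foldF v k (φ ∨ ψ) = on-∨ (foldF v k φ) (foldF v k ψ)
  foldF v k (∀' φ) = on-∀ (foldF v (suc k) φ)
  foldF v k (∃' φ) = on-∃ (foldF v (suc k) φ)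
  foldF v k (□ i φ) = on-□ i (foldF v k φ)

  termNode : (ℕ → ℕ) → (tag payload : ℕ) → (ℕ → ℕ) → ℕ
  termNode w tag p rec = select tag
    ( w p
    ∷ on-zer
    ∷ on-S (rec p)
    ∷ on-⊕ (rec (cantor₁ p)) (rec (cantor₂ p))
    ∷ on-⊗ (rec (cantor₁ p)) (rec (cantor₂ p))
    ∷ [])

  termStep : (ℕ → ℕ → ℕ) → ℕ → ℕ → ℕ → ℕ
  termStep v k m h = ifz m on-zer (termNode (v k) (cantor₁ (pred m)) (cantor₂ (pred m)) (entry m h))

  foldCodeT : (ℕ → ℕ → ℕ) → ℕ → ℕ → ℕ
  foldCodeT v = courseOfValues (termStep v)

  termTable : (ℕ → ℕ → ℕ) → ℕ → ℕ → ℕ → ℕ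
  termTable v k m = entry m (history (termStep v) k m)

  foldCodeT-unfold : ∀ v k {m tag} → cantor₁ m ≡ tag →
                     foldCodeT v k (suc m) ≡ termNode (v k) tag (cantor₂ m) (termTable v k (suc m))
  foldCodeT-unfold v k refl = refl

  mutual
    foldCodeT-correct : ∀ v k {m t} → TermCode m t → foldCodeT v k m ≡ foldT (v k) t
    foldCodeT-correct v k code-0 = refl
    foldCodeT-correct v k (code-var tag) = foldCodeT-unfold v k tag
    foldCodeT-correct v k (code-zer tag) = foldCodeT-unfold v k tag
    foldCodeT-correct v k {suc m} (code-S tag c) =
      trans (foldCodeT-unfold v k tag) (cong on-S (termTable-correct v k (payload-< m) c))
    foldCodeT-correct v k {suc m} (code-⊕ tag c d) =
      trans (foldCodeT-unfold v k tag) (cong₂ on-⊕ (termTable-correct v k (left-< m) c) (termTable-correct v k (right-< m) d))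
    foldCodeT-correct v k {suc m} (code-⊗ tag c d) =
      trans (foldCodeT-unfold v k tag) (cong₂ on-⊗ (termTable-correct v k (left-< m) c) (termTable-correct v k (right-< m) d))

    termTable-correct : ∀ v k {m j t} → j < m → TermCode j t → termTable v k m j ≡ foldT (v k) t
    termTable-correct v k j<m c = trans (entry-history (termStep v) k j<m) (foldCodeT-correct v k c)

  formulaNode : (ℕ → ℕ → ℕ) → (depth tag payload : ℕ) → (ℕ → ℕ → ℕ) → ℕ
  formulaNode v k tag p rec = select tag
    ( on-== (foldCodeT v k (cantor₁ p)) (foldCodeT v k (cantor₂ p))
    ∷ on-⊥
    ∷ on-⇒ (rec k (cantor₁ p)) (rec k (cantor₂ p))
    ∷ on-∧ (rec k (cantor₁ p)) (rec k (cantor₂ p))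
    ∷ on-∨ (rec k (cantor₁ p)) (rec k (cantor₂ p))
    ∷ on-∀ (rec (suc k) p)
    ∷ on-∃ (rec (suc k) p)
    ∷ on-□ (cantor₁ p) (rec k (cantor₂ p))
    ∷ [])

  -- The depth changes under binders, so the recursion runs over the pairs
  -- cantor k m of a depth and a code; the parameter of the step is unused.
  formulaStep : (ℕ → ℕ → ℕ) → ℕ → ℕ → ℕ → ℕ
  formulaStep v _ n h = ifz (cantor₂ n) on-⊥
    (formulaNode v (cantor₁ n) (cantor₁ (pred (cantor₂ n))) (cantor₂ (pred (cantor₂ n))) λ k c → entry n h (cantor k c))

  foldCodeF : (ℕ → ℕ → ℕ) → ℕ → ℕ → ℕ
  foldCodeF v k m = courseOfValues (formulaStep v) 0 (cantor k m)

  foldCodeF-zero : ∀ v k → foldCodeF v k 0 ≡ on-⊥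
  foldCodeF-zero v k rewrite cantor₂-cantor k 0 = refl

  formulaTable : (ℕ → ℕ → ℕ) → ℕ → ℕ → ℕ → ℕ → ℕ
  formulaTable v k m k′ c = entry (cantor k m) (history (formulaStep v) 0 (cantor k m)) (cantor k′ c)

  foldCodeF-unfold : ∀ v k {m tag} → cantor₁ m ≡ tag →
                     foldCodeF v k (suc m) ≡ formulaNode v k tag (cantor₂ m) (formulaTable v k (suc m))
  foldCodeF-unfold v k {m} refl rewrite cantor₁-cantor k (suc m) | cantor₂-cantor k (suc m) = refl

  mutual
    foldCodeF-correct : ∀ v k {m φ} → FormulaCode m φ → foldCodeF v k m ≡ foldF v k φ
    foldCodeF-correct v k code-0 = foldCodeF-zero v k
    foldCodeF-correct v k (code-== tag c d) =
      trans (foldCodeF-unfold v k tag) (cong₂ on-== (foldCodeT-correct v k c) (foldCodeT-correct v k d))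
    foldCodeF-correct v k (code-⊥ tag) = foldCodeF-unfold v k tag
    foldCodeF-correct v k {suc m} (code-⇒ tag c d) =
      trans (foldCodeF-unfold v k tag) (cong₂ on-⇒
        (formulaTable-correct v k (cantor-monoʳ-< k (left-< m)) c) (formulaTable-correct v k (cantor-monoʳ-< k (right-< m)) d))
    foldCodeF-correct v k {suc m} (code-∧ tag c d) =
      trans (foldCodeF-unfold v k tag) (cong₂ on-∧
        (formulaTable-correct v k (cantor-monoʳ-< k (left-< m)) c) (formulaTable-correct v k (cantor-monoʳ-< k (right-< m)) d))
    foldCodeF-correct v k {suc m} (code-∨ tag c d) =
      trans (foldCodeF-unfold v k tag) (cong₂ on-∨
        (formulaTable-correct v k (cantor-monoʳ-< k (left-< m)) c) (formulaTable-correct v k (cantor-monoʳ-< k (right-< m)) d))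
    foldCodeF-correct v k {suc m} (code-∀ tag c) =
      trans (foldCodeF-unfold v k tag) (cong on-∀ (formulaTable-correct v k (cantor-suc-< k (payload-< m)) c))
    foldCodeF-correct v k {suc m} (code-∃ tag c) =
      trans (foldCodeF-unfold v k tag) (cong on-∃ (formulaTable-correct v k (cantor-suc-< k (payload-< m)) c))
    foldCodeF-correct v k {suc m} (code-□ tag c) =
      trans (foldCodeF-unfold v k tag) (cong (on-□ (left m)) (formulaTable-correct v k (cantor-monoʳ-< k (right-< m)) c))

    formulaTable-correct : ∀ v k {m k′ j φ} → cantor k′ j < cantor k (suc m) → FormulaCode j φ →
                           formulaTable v k (suc m) k′ j ≡ foldF v k′ φ
    formulaTable-correct v k {k′ = k′} lt c = trans (entry-history (formulaStep v) 0 lt) (foldCodeF-correct v k′ c)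

module _ {A : Algebra} (pa : PrimRecAlgebra A) {v : ℕ → ℕ → ℕ} (pv : PrimRec₂ v) where
  open Algebra A
  open PrimRecAlgebra pa

  pr-foldCodeT : PrimRec₂ (foldCodeT A v)
  pr-foldCodeT = pr-courseOfValues {step = termStep A v} pr-termStep
    where
    p : PrimRec {3} λ xs → cantor₂ (pred (lookup xs (fs fz)))
    p = cantor₂ᵖ (pr-comp₁ {f = pred} pr-pred x₁)
    rec : ∀ {f} → PrimRec f → PrimRec λ xs → entry (lookup xs (fs fz)) (lookup xs (fs (fs fz))) (f xs)
    rec = entryᵖ x₁ x₂
    pr-termStep : PrimRec₃ (termStep A v)
    pr-termStep = pr-comp₃ {f = ifz} pr-ifz x₁ (pr-const on-zer) (selectᵖ (cantor₁ᵖ (pr-comp₁ {f = pred} pr-pred x₁))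
      ( pr-comp₂ {f = v} pv x₀ p
      ∷ pr-const on-zer
      ∷ pr-comp₁ {f = on-S} pr-S (rec p)
      ∷ pr-comp₂ {f = on-⊕} pr-⊕ (rec (cantor₁ᵖ p)) (rec (cantor₂ᵖ p))
      ∷ pr-comp₂ {f = on-⊗} pr-⊗ (rec (cantor₁ᵖ p)) (rec (cantor₂ᵖ p))
      ∷ []))

  pr-foldCodeF : PrimRec₂ (foldCodeF A v)
  pr-foldCodeF = pr-comp₂ {f = courseOfValues (formulaStep A v)} (pr-courseOfValues {step = formulaStep A v} pr-formulaStep)
                   (pr-const 0) (cantorᵖ x₀ x₁)
    where
    k : PrimRec {3} λ xs → cantor₁ (lookup xs (fs fz))
    k = cantor₁ᵖ x₁
    p : PrimRec {3} λ xs → cantor₂ (pred (cantor₂ (lookup xs (fs fz))))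
    p = cantor₂ᵖ (pr-comp₁ {f = pred} pr-pred (cantor₂ᵖ x₁))
    rec : ∀ {f g} → PrimRec f → PrimRec g →
          PrimRec λ xs → entry (lookup xs (fs fz)) (lookup xs (fs (fs fz))) (cantor (f xs) (g xs))
    rec k′ c = entryᵖ x₁ x₂ (cantorᵖ k′ c)
    term : ∀ {f} → PrimRec f → PrimRec λ xs → foldCodeT A v (cantor₁ (lookup xs (fs fz))) (f xs)
    term c = pr-comp₂ {f = foldCodeT A v} pr-foldCodeT k c
    pr-formulaStep : PrimRec₃ (formulaStep A v)
    pr-formulaStep = pr-comp₃ {f = ifz} pr-ifz (cantor₂ᵖ x₁) (pr-const on-⊥) (selectᵖ (cantor₁ᵖ (pr-comp₁ {f = pred} pr-pred (cantor₂ᵖ x₁)))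
      ( pr-comp₂ {f = on-==} pr-== (term (cantor₁ᵖ p)) (term (cantor₂ᵖ p))
      ∷ pr-const on-⊥
      ∷ pr-comp₂ {f = on-⇒} pr-⇒ (rec k (cantor₁ᵖ p)) (rec k (cantor₂ᵖ p))
      ∷ pr-comp₂ {f = on-∧} pr-∧ (rec k (cantor₁ᵖ p)) (rec k (cantor₂ᵖ p))
      ∷ pr-comp₂ {f = on-∨} pr-∨ (rec k (cantor₁ᵖ p)) (rec k (cantor₂ᵖ p))
      ∷ pr-comp₁ {f = on-∀} pr-∀ (rec (pr-comp₁ {f = suc} pr-suc k) p)
      ∷ pr-comp₁ {f = on-∃} pr-∃ (rec (pr-comp₁ {f = suc} pr-suc k) p)
      ∷ pr-comp₂ {f = on-□} pr-□ (cantor₁ᵖ p) (rec k (cantor₂ᵖ p))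
      ∷ []))

  pr-foldCodeF₀ : PrimRec₁ (foldCodeF A v 0)
  pr-foldCodeF₀ = pr-comp₂ {f = foldCodeF A v} pr-foldCodeF (pr-const 0) x₀

codeAlgebra : Algebra
codeAlgebra = record
  { on-zer = pair 1 0
  ; on-S = pair 2
  ; on-⊕ = λ a b → pair 3 (pair a b)
  ; on-⊗ = λ a b → pair 4 (pair a b)
  ; on-== = λ a b → pair 0 (pair a b)
  ; on-⊥ = pair 1 0
  ; on-⇒ = λ a b → pair 2 (pair a b)
  ; on-∧ = λ a b → pair 3 (pair a b)
  ; on-∨ = λ a b → pair 4 (pair a b)
  ; on-∀ = pair 5
  ; on-∃ = pair 6
  ; on-□ = λ i a → pair 7 (pair i a)
  }

boundAlgebra : Algebra
boundAlgebra = record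
  { on-zer = 0
  ; on-S = λ a → a
  ; on-⊕ = _⊔_
  ; on-⊗ = _⊔_
  ; on-== = _⊔_
  ; on-⊥ = 0
  ; on-⇒ = _⊔_
  ; on-∧ = _⊔_
  ; on-∨ = _⊔_
  ; on-∀ = _∸ 1
  ; on-∃ = _∸ 1
  ; on-□ = λ _ a → a
  }

pr-codeAlgebra : PrimRecAlgebra codeAlgebra
pr-codeAlgebra = record
  { pr-S = pairᵖ (pr-const 2) x₀
  ; pr-⊕ = pairᵖ (pr-const 3) (pairᵖ x₀ x₁)
  ; pr-⊗ = pairᵖ (pr-const 4) (pairᵖ x₀ x₁)
  ; pr-== = pairᵖ (pr-const 0) (pairᵖ x₀ x₁)
  ; pr-⇒ = pairᵖ (pr-const 2) (pairᵖ x₀ x₁)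
  ; pr-∧ = pairᵖ (pr-const 3) (pairᵖ x₀ x₁)
  ; pr-∨ = pairᵖ (pr-const 4) (pairᵖ x₀ x₁)
  ; pr-∀ = pairᵖ (pr-const 5) x₀
  ; pr-∃ = pairᵖ (pr-const 6) x₀
  ; pr-□ = pairᵖ (pr-const 7) (pairᵖ x₀ x₁)
  }

pr-boundAlgebra : PrimRecAlgebra boundAlgebra
pr-boundAlgebra = record
  { pr-S = x₀
  ; pr-⊕ = x₀ ⊔ᵖ x₁
  ; pr-⊗ = x₀ ⊔ᵖ x₁
  ; pr-== = x₀ ⊔ᵖ x₁
  ; pr-⇒ = x₀ ⊔ᵖ x₁
  ; pr-∧ = x₀ ⊔ᵖ x₁
  ; pr-∨ = x₀ ⊔ᵖ x₁
  ; pr-∀ = x₀ ∸ᵖ pr-const 1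
  ; pr-∃ = x₀ ∸ᵖ pr-const 1
  ; pr-□ = x₁
  }

codeT≡foldT : ∀ t → codeT t ≡ foldT codeAlgebra (pair 0) t
codeT≡foldT (var x) = refl
codeT≡foldT zer = refl
codeT≡foldT (S t) = cong (pair 2) (codeT≡foldT t)
codeT≡foldT (t ⊕ u) = cong₂ (λ a b → pair 3 (pair a b)) (codeT≡foldT t) (codeT≡foldT u)
codeT≡foldT (t ⊗ u) = cong₂ (λ a b → pair 4 (pair a b)) (codeT≡foldT t) (codeT≡foldT u)

code≡foldF : ∀ k φ → code φ ≡ foldF codeAlgebra (λ _ → pair 0) k φ
code≡foldF k (t == u) = cong₂ (λ a b → pair 0 (pair a b)) (codeT≡foldT t) (codeT≡foldT u)
code≡foldF k ⊥' = refl
code≡foldF k (φ ⇒ ψ) = cong₂ (λ a b → pair 2 (pair a b)) (code≡foldF k φ) (code≡foldF k ψ)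
code≡foldF k (φ ∧ ψ) = cong₂ (λ a b → pair 3 (pair a b)) (code≡foldF k φ) (code≡foldF k ψ)
code≡foldF k (φ ∨ ψ) = cong₂ (λ a b → pair 4 (pair a b)) (code≡foldF k φ) (code≡foldF k ψ)
code≡foldF k (∀' φ) = cong (pair 5) (code≡foldF (suc k) φ)
code≡foldF k (∃' φ) = cong (pair 6) (code≡foldF (suc k) φ)
code≡foldF k (□ i φ) = cong (λ a → pair 7 (pair i a)) (code≡foldF k φ)

boundT≡foldT : ∀ t → boundT t ≡ foldT boundAlgebra suc t
boundT≡foldT (var x) = refl
boundT≡foldT zer = refl
boundT≡foldT (S t) = boundT≡foldT t
boundT≡foldT (t ⊕ u) = cong₂ _⊔_ (boundT≡foldT t) (boundT≡foldT u)
boundT≡foldT (t ⊗ u) = cong₂ _⊔_ (boundT≡foldT t) (boundT≡foldT u)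

bound≡foldF : ∀ k φ → bound φ ≡ foldF boundAlgebra (λ _ → suc) k φ
bound≡foldF k (t == u) = cong₂ _⊔_ (boundT≡foldT t) (boundT≡foldT u)
bound≡foldF k ⊥' = refl
bound≡foldF k (φ ⇒ ψ) = cong₂ _⊔_ (bound≡foldF k φ) (bound≡foldF k ψ)
bound≡foldF k (φ ∧ ψ) = cong₂ _⊔_ (bound≡foldF k φ) (bound≡foldF k ψ)
bound≡foldF k (φ ∨ ψ) = cong₂ _⊔_ (bound≡foldF k φ) (bound≡foldF k ψ)
bound≡foldF k (∀' φ) = cong (_∸ 1) (bound≡foldF (suc k) φ)
bound≡foldF k (∃' φ) = cong (_∸ 1) (bound≡foldF (suc k) φ)
bound≡foldF k (□ i φ) = bound≡foldF k φ

foldT-subT : ∀ A w τ t → foldT A w (subT τ t) ≡ foldT A (λ x → foldT A w (τ x)) t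
foldT-subT A w τ (var x) = refl
foldT-subT A w τ zer = refl
foldT-subT A w τ (S t) = cong (Algebra.on-S A) (foldT-subT A w τ t)
foldT-subT A w τ (t ⊕ u) = cong₂ (Algebra.on-⊕ A) (foldT-subT A w τ t) (foldT-subT A w τ u)
foldT-subT A w τ (t ⊗ u) = cong₂ (Algebra.on-⊗ A) (foldT-subT A w τ t) (foldT-subT A w τ u)

-- Under k binders of φ, the substitution acts on the variables as extSⁿ k σ.
substVar : Algebra → (ℕ → ℕ) → (ℕ → Term) → ℕ → ℕ → ℕ
substVar A w σ k x = foldT A w (extSⁿ k σ x)

foldF-sub : ∀ A w σ j k φ → foldF A (λ _ → w) j (sub (extSⁿ k σ) φ) ≡ foldF A (substVar A w σ) k φ
foldF-sub A w σ j k (t == u) = cong₂ (Algebra.on-== A) (foldT-subT A w (extSⁿ k σ) t) (foldT-subT A w (extSⁿ k σ) u)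
foldF-sub A w σ j k ⊥' = refl
foldF-sub A w σ j k (φ ⇒ ψ) = cong₂ (Algebra.on-⇒ A) (foldF-sub A w σ j k φ) (foldF-sub A w σ j k ψ)
foldF-sub A w σ j k (φ ∧ ψ) = cong₂ (Algebra.on-∧ A) (foldF-sub A w σ j k φ) (foldF-sub A w σ j k ψ)
foldF-sub A w σ j k (φ ∨ ψ) = cong₂ (Algebra.on-∨ A) (foldF-sub A w σ j k φ) (foldF-sub A w σ j k ψ)
foldF-sub A w σ j k (∀' φ) = cong (Algebra.on-∀ A) (foldF-sub A w σ (suc j) (suc k) φ)
foldF-sub A w σ j k (∃' φ) = cong (Algebra.on-∃ A) (foldF-sub A w σ (suc j) (suc k) φ)
foldF-sub A w σ j k (□ i φ) = cong (Algebra.on-□ A i) (foldF-sub A w σ j k φ)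

code-sub : ∀ σ φ → code (sub σ φ) ≡ foldF codeAlgebra (substVar codeAlgebra (pair 0) σ) 0 φ
code-sub σ φ = trans (code≡foldF 0 (sub σ φ)) (foldF-sub codeAlgebra (pair 0) σ 0 0 φ)

bound-sub : ∀ σ φ → bound (sub σ φ) ≡ foldF boundAlgebra (substVar boundAlgebra suc σ) 0 φ
bound-sub σ φ = trans (bound≡foldF 0 (sub σ φ)) (foldF-sub boundAlgebra suc σ 0 0 φ)

trichotomy : {A : Set} → ℕ → ℕ → (lt eq gt : A) → A
trichotomy zero zero lt eq gt = eq
trichotomy zero (suc _) lt eq gt = lt
trichotomy (suc _) zero lt eq gt = gt
trichotomy (suc x) (suc k) lt eq gt = trichotomy x k lt eq gt

trichotomy-map : ∀ {A B : Set} (f : A → B) x k lt eq gt →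
                 f (trichotomy x k lt eq gt) ≡ trichotomy x k (f lt) (f eq) (f gt)
trichotomy-map f zero zero lt eq gt = refl
trichotomy-map f zero (suc k) lt eq gt = refl
trichotomy-map f (suc x) zero lt eq gt = refl
trichotomy-map f (suc x) (suc k) lt eq gt = trichotomy-map f x k lt eq gt

trichotomy≡ifz : ∀ x k lt eq gt → trichotomy x k lt eq gt ≡ ifz (k ∸ x) (ifz (x ∸ k) eq gt) lt
trichotomy≡ifz zero zero lt eq gt = refl
trichotomy≡ifz zero (suc k) lt eq gt = refl
trichotomy≡ifz (suc x) zero lt eq gt = refl
trichotomy≡ifz (suc x) (suc k) lt eq gt = trichotomy≡ifz x k lt eq gt

trichotomyᵖ : ∀ {n} {x k lt eq gt : Fn n} → PrimRec x → PrimRec k → PrimRec lt → PrimRec eq → PrimRec gt →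
              PrimRec λ xs → trichotomy (x xs) (k xs) (lt xs) (eq xs) (gt xs)
trichotomyᵖ {x = x} {k} {lt} {eq} {gt} px pk plt peq pgt =
  PrimRec-resp (λ xs → sym (trichotomy≡ifz (x xs) (k xs) (lt xs) (eq xs) (gt xs)))
    (pr-comp₃ {f = ifz} pr-ifz (pk ∸ᵖ px) (pr-comp₃ {f = ifz} pr-ifz (px ∸ᵖ pk) peq pgt) plt)

extSⁿ-σ₀ : ∀ k x → extSⁿ k σ₀ x ≡ trichotomy x k (var x) zer (var (pred x))
extSⁿ-σ₀ zero zero = refl
extSⁿ-σ₀ zero (suc x) = refl
extSⁿ-σ₀ (suc k) zero = refl
extSⁿ-σ₀ (suc k) (suc x) = begin
  renT suc (extSⁿ k σ₀ x)                               ≡⟨ cong (renT suc) (extSⁿ-σ₀ k x) ⟩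
  renT suc (trichotomy x k (var x) zer (var (pred x)))  ≡⟨ trichotomy-map (renT suc) x k _ _ _ ⟩
  trichotomy x k (var (suc x)) zer (var (suc (pred x))) ≡⟨ above-suc-pred x k ⟩
  trichotomy x k (var (suc x)) zer (var x)              ∎
  where
  open ≡-Reasoning
  -- x = suc (pred x) in the branch x > k
  above-suc-pred : ∀ x k → trichotomy x k (var (suc x)) zer (var (suc (pred x))) ≡ trichotomy x k (var (suc x)) zer (var x)
  above-suc-pred zero zero = refl
  above-suc-pred zero (suc k) = refl
  above-suc-pred (suc x) k = refl

extSⁿ-σ₁ : ∀ k x → extSⁿ k σ₁ x ≡ trichotomy x k (var x) (S (var x)) (var x)
extSⁿ-σ₁ zero zero = refl
extSⁿ-σ₁ zero (suc x) = refl
extSⁿ-σ₁ (suc k) zero = refl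
extSⁿ-σ₁ (suc k) (suc x) =
  trans (cong (renT suc) (extSⁿ-σ₁ k x)) (trichotomy-map (renT suc) x k (var x) (S (var x)) (var x))

substVar-σ₀ : ∀ A w k x → substVar A w σ₀ k x ≡ trichotomy x k (w x) (Algebra.on-zer A) (w (pred x))
substVar-σ₀ A w k x = trans (cong (foldT A w) (extSⁿ-σ₀ k x)) (trichotomy-map (foldT A w) x k (var x) zer (var (pred x)))

substVar-σ₁ : ∀ A w k x → substVar A w σ₁ k x ≡ trichotomy x k (w x) (Algebra.on-S A (w x)) (w x)
substVar-σ₁ A w k x = trans (cong (foldT A w) (extSⁿ-σ₁ k x)) (trichotomy-map (foldT A w) x k (var x) (S (var x)) (var x))

module _ {A : Algebra} {w : ℕ → ℕ} (pw : PrimRec₁ w) where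

  pr-substVar-σ₀ : PrimRec₂ (substVar A w σ₀)
  pr-substVar-σ₀ = PrimRec-resp (λ xs → sym (substVar-σ₀ A w (lookup xs fz) (lookup xs (fs fz))))
    (trichotomyᵖ x₁ x₀ (pr-comp₁ {f = w} pw x₁) (pr-const (Algebra.on-zer A)) (pr-comp₁ {f = w} pw (pr-comp₁ {f = pred} pr-pred x₁)))

  pr-substVar-σ₁ : PrimRecAlgebra A → PrimRec₂ (substVar A w σ₁)
  pr-substVar-σ₁ pa = PrimRec-resp (λ xs → sym (substVar-σ₁ A w (lookup xs fz) (lookup xs (fs fz))))
    (trichotomyᵖ x₁ x₀ (pr-comp₁ {f = w} pw x₁)
                       (pr-comp₁ {f = Algebra.on-S A} (PrimRecAlgebra.pr-S pa) (pr-comp₁ {f = w} pw x₁))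
                       (pr-comp₁ {f = w} pw x₁))

-- Codes of the induction axioms

allsCode : ℕ → ℕ → ℕ
allsCode zero c = c
allsCode (suc n) c = pair 5 (allsCode n c)

code-alls : ∀ n φ → code (alls n φ) ≡ allsCode n (code φ)
code-alls zero φ = refl
code-alls (suc n) φ = cong (pair 5) (code-alls n φ)

pr-allsCode : PrimRec₂ allsCode
pr-allsCode = pr-rec₂ {f = allsCode} {h = λ _ c _ → pair 5 c} x₀ (pairᵖ (pr-const 5) x₁) (λ _ → refl) (λ _ _ → refl)

code-indBody-shape : ∀ φ X Y → code ((X ∧ ∀' (φ ⇒ Y)) ⇒ ∀' φ) ≡
                     pair 2 (pair (pair 3 (pair (code X) (pair 5 (pair 2 (pair (code φ) (code Y)))))) (pair 5 (code φ)))
code-indBody-shape φ X Y = refl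

-- Opaque, and code (indBody φ) is unfolded only through code-indBody-shape:
-- comparing two unfoldings of pair is exponentially expensive.
opaque
  inductionCode : (c c₀ c₁ b b₀ b₁ : ℕ) → ℕ
  inductionCode c c₀ c₁ b b₀ b₁ =
    allsCode ((b₀ ⊔ ((b ⊔ b₁) ∸ 1)) ⊔ (b ∸ 1))
             (pair 2 (pair (pair 3 (pair c₀ (pair 5 (pair 2 (pair c c₁))))) (pair 5 c)))

  code-closure-indBody : ∀ φ → code (closure (indBody φ)) ≡
    inductionCode (code φ) (code (sub σ₀ φ)) (code (sub σ₁ φ)) (bound φ) (bound (sub σ₀ φ)) (bound (sub σ₁ φ))
  code-closure-indBody φ = begin
    code (closure (indBody φ))
      ≡⟨ code-alls (bound (indBody φ)) (indBody φ) ⟩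
    allsCode (bound (indBody φ)) (code (indBody φ))
      ≡⟨ cong (allsCode (bound (indBody φ))) (cong code indBody-unfold) ⟩
    allsCode (bound (indBody φ)) (code ((sub σ₀ φ ∧ ∀' (φ ⇒ sub σ₁ φ)) ⇒ ∀' φ))
      ≡⟨ cong (allsCode (bound (indBody φ))) (code-indBody-shape φ (sub σ₀ φ) (sub σ₁ φ)) ⟩
    inductionCode (code φ) (code (sub σ₀ φ)) (code (sub σ₁ φ)) (bound φ) (bound (sub σ₀ φ)) (bound (sub σ₁ φ)) ∎
    where
    open ≡-Reasoning
    indBody-unfold : indBody φ ≡ ((sub σ₀ φ ∧ ∀' (φ ⇒ sub σ₁ φ)) ⇒ ∀' φ)
    indBody-unfold = refl

  inductionCodeᵖ : ∀ {n} {c c₀ c₁ b b₀ b₁ : Fn n} →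
                   PrimRec c → PrimRec c₀ → PrimRec c₁ → PrimRec b → PrimRec b₀ → PrimRec b₁ →
                   PrimRec λ xs → inductionCode (c xs) (c₀ xs) (c₁ xs) (b xs) (b₀ xs) (b₁ xs)
  inductionCodeᵖ c c₀ c₁ b b₀ b₁ =
    pr-comp₂ {f = allsCode} pr-allsCode ((b₀ ⊔ᵖ ((b ⊔ᵖ b₁) ∸ᵖ pr-const 1)) ⊔ᵖ (b ∸ᵖ pr-const 1))
      (pairᵖ (pr-const 2) (pairᵖ (pairᵖ (pr-const 3) (pairᵖ c₀ (pairᵖ (pr-const 5) (pairᵖ (pr-const 2) (pairᵖ c c₁)))))
                                 (pairᵖ (pr-const 5) c)))

inductionCode-cong : ∀ {c c₀ c₁ b b₀ b₁ c′ c₀′ c₁′ b′ b₀′ b₁′} →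
                     c ≡ c′ → c₀ ≡ c₀′ → c₁ ≡ c₁′ → b ≡ b′ → b₀ ≡ b₀′ → b₁ ≡ b₁′ →
                     inductionCode c c₀ c₁ b b₀ b₁ ≡ inductionCode c′ c₀′ c₁′ b′ b₀′ b₁′
inductionCode-cong refl refl refl refl refl refl = refl

inductionAxiomCode : ℕ → ℕ
inductionAxiomCode w = inductionCode
  (foldCodeF codeAlgebra (λ _ → pair 0) 0 w)
  (foldCodeF codeAlgebra (substVar codeAlgebra (pair 0) σ₀) 0 w)
  (foldCodeF codeAlgebra (substVar codeAlgebra (pair 0) σ₁) 0 w)
  (foldCodeF boundAlgebra (λ _ → suc) 0 w)
  (foldCodeF boundAlgebra (substVar boundAlgebra suc σ₀) 0 w)
  (foldCodeF boundAlgebra (substVar boundAlgebra suc σ₁) 0 w)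

inductionAxiomCode-correct : ∀ {w φ} → FormulaCode w φ → inductionAxiomCode w ≡ code (closure (indBody φ))
inductionAxiomCode-correct {φ = φ} c = trans
  (inductionCode-cong
    (trans (foldCodeF-correct codeAlgebra (λ _ → pair 0) 0 c) (sym (code≡foldF 0 φ)))
    (trans (foldCodeF-correct codeAlgebra (substVar codeAlgebra (pair 0) σ₀) 0 c) (sym (code-sub σ₀ φ)))
    (trans (foldCodeF-correct codeAlgebra (substVar codeAlgebra (pair 0) σ₁) 0 c) (sym (code-sub σ₁ φ)))
    (trans (foldCodeF-correct boundAlgebra (λ _ → suc) 0 c) (sym (bound≡foldF 0 φ)))
    (trans (foldCodeF-correct boundAlgebra (substVar boundAlgebra suc σ₀) 0 c) (sym (bound-sub σ₀ φ)))
    (trans (foldCodeF-correct boundAlgebra (substVar boundAlgebra suc σ₁) 0 c) (sym (bound-sub σ₁ φ))))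
  (sym (code-closure-indBody φ))

-- The implicit handlers are given explicitly: inferring them would unfold the folds.
pr-inductionAxiomCode : PrimRec₁ inductionAxiomCode
pr-inductionAxiomCode = inductionCodeᵖ
  (pr-foldCodeF₀ pr-codeAlgebra {λ _ → pair 0} (pairᵖ (pr-const 0) x₁))
  (pr-foldCodeF₀ pr-codeAlgebra {substVar codeAlgebra (pair 0) σ₀} (pr-substVar-σ₀ (pairᵖ (pr-const 0) x₀)))
  (pr-foldCodeF₀ pr-codeAlgebra {substVar codeAlgebra (pair 0) σ₁} (pr-substVar-σ₁ (pairᵖ (pr-const 0) x₀) pr-codeAlgebra))
  (pr-foldCodeF₀ pr-boundAlgebra {λ _ → suc} (pr-comp₁ {f = suc} pr-suc x₁))
  (pr-foldCodeF₀ pr-boundAlgebra {substVar boundAlgebra suc σ₀} (pr-substVar-σ₀ (pr-comp₁ {f = suc} pr-suc x₀)))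
  (pr-foldCodeF₀ pr-boundAlgebra {substVar boundAlgebra suc σ₁} (pr-substVar-σ₁ (pr-comp₁ {f = suc} pr-suc x₀) pr-boundAlgebra))

enumerate : ∀ {k} → Vec ℕ k → (ℕ → ℕ) → ℕ → ℕ
enumerate {k} cs f m = select m (cs ∷ʳ f (m ∸ k))

enumerate-∷ : ∀ {k} c (cs : Vec ℕ k) f m → enumerate (c ∷ cs) f m ≡ ifz m c (enumerate cs f (pred m))
enumerate-∷ c cs f zero = select-ifz 0 c (cs ∷ʳ f 0)
enumerate-∷ {k} c cs f (suc m) = select-ifz (suc m) c (cs ∷ʳ f (m ∸ k))

enumerate-lookup : ∀ {k} (cs : Vec ℕ k) f i → enumerate cs f (toℕ i) ≡ lookup cs i
enumerate-lookup (c ∷ cs) f fz = enumerate-∷ c cs f 0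
enumerate-lookup (c ∷ cs) f (fs i) = trans (enumerate-∷ c cs f (suc (toℕ i))) (enumerate-lookup cs f i)

enumerate-beyond : ∀ {k} (cs : Vec ℕ k) f w → enumerate cs f (k + w) ≡ f w
enumerate-beyond [] f w = refl
enumerate-beyond {suc k} (c ∷ cs) f w = trans (enumerate-∷ c cs f (suc (k + w))) (enumerate-beyond cs f w)

enumerate-cases : ∀ {k} (cs : Vec ℕ k) f m →
                  (∃ λ i → enumerate cs f m ≡ lookup cs i) ⊎ (∃ λ w → enumerate cs f m ≡ f w)
enumerate-cases [] f m = inj₂ (m , refl)
enumerate-cases (c ∷ cs) f zero = inj₁ (fz , enumerate-∷ c cs f 0)
enumerate-cases (c ∷ cs) f (suc m) with enumerate-cases cs f m
... | inj₁ (i , e) = inj₁ (fs i , trans (enumerate-∷ c cs f (suc m)) e)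
... | inj₂ (w , e) = inj₂ (w , trans (enumerate-∷ c cs f (suc m)) e)

pr-enumerate : ∀ {k} (cs : Vec ℕ k) {f} → PrimRec₁ f → PrimRec₁ (enumerate cs f)
pr-enumerate [] pf = pf
pr-enumerate (c ∷ cs) {f} pf =
  PrimRec-resp (λ xs → sym (enumerate-∷ c cs f (lookup xs fz)))
    (pr-comp₃ {f = ifz} pr-ifz x₀ (pr-const c) (pr-comp₁ {f = enumerate cs f} (pr-enumerate cs {f} pf) (pr-comp₁ {f = pred} pr-pred x₀)))

RE-image : ∀ {g : ℕ → ℕ} → PrimRec₁ g → RE λ n → ∃ λ m → n ≡ g m
RE-image {g} pg = proj₁ acceptor , λ n → mk⇔ (accepted n) (image n)
  where
  acceptor : PrimRec₂ λ n m → ifz ∣ n - g m ∣ 1 0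
  acceptor = pr-comp₃ {f = ifz} pr-ifz ∣ x₀ - pr-comp₁ {f = g} pg x₁ ∣ᵖ (pr-const 1) (pr-const 0)
  accepted : ∀ n → (∃ λ m → n ≡ g m) → ∃ λ m → evalPR (proj₁ acceptor) (n ∷ m ∷ []) ≢ 0
  accepted n (m , n≡gm) = m , λ eval≡0 → 1≢0 (trans (sym acceptor≡1) eval≡0)
    where
    1≢0 : 1 ≢ 0
    1≢0 ()
    acceptor≡1 : evalPR (proj₁ acceptor) (n ∷ m ∷ []) ≡ 1
    acceptor≡1 = trans (proj₂ acceptor (n ∷ m ∷ [])) (cong (λ d → ifz d 1 0) (m≡n⇒∣m-n∣≡0 n≡gm))

  image : ∀ n → (∃ λ m → evalPR (proj₁ acceptor) (n ∷ m ∷ []) ≢ 0) → ∃ λ m → n ≡ g m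
  image n (m , eval≢0) with ∣ n - g m ∣ in d
  ... | zero = m , ∣m-n∣≡0⇒m≡n d
  ... | suc _ = ⊥-elim (eval≢0 (trans (proj₂ acceptor (n ∷ m ∷ [])) (cong (λ x → ifz x 1 0) d)))

RE-resp : ∀ {P Q : ℕ → Set} → (∀ n → P n ⇔ Q n) → RE P → RE Q
RE-resp P⇔Q (R , P⇔R) = R , λ n → mk⇔ (to (P⇔R n) ∘ from (P⇔Q n)) (to (P⇔Q n) ∘ from (P⇔R n))

-- Enumerating the axioms of PA

basicAxioms : Vec Formula 6
basicAxioms =
  ∀' (¬' (S v0 == zer)) ∷
  ∀' (∀' (S v1 == S v0 ⇒ v1 == v0)) ∷
  ∀' (v0 ⊕ zer == v0) ∷
  ∀' (∀' (v1 ⊕ S v0 == S (v1 ⊕ v0))) ∷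
  ∀' (v0 ⊗ zer == zer) ∷
  ∀' (∀' (v1 ⊗ S v0 == (v1 ⊗ v0) ⊕ v1)) ∷ []

basicAxioms-PA : ∀ i → PA (lookup basicAxioms i)
basicAxioms-PA fz = ax-S0
basicAxioms-PA (fs fz) = ax-Sinj
basicAxioms-PA (fs (fs fz)) = ax-+0
basicAxioms-PA (fs (fs (fs fz))) = ax-+S
basicAxioms-PA (fs (fs (fs (fs fz)))) = ax-*0
basicAxioms-PA (fs (fs (fs (fs (fs fz))))) = ax-*S

PA-cases : ∀ {φ} → PA φ → (∃ λ i → lookup basicAxioms i ≡ φ) ⊎ (∃ λ ψ → closure (indBody ψ) ≡ φ)
PA-cases ax-S0 = inj₁ (fz , refl)
PA-cases ax-Sinj = inj₁ (fs fz , refl)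
PA-cases ax-+0 = inj₁ (fs (fs fz) , refl)
PA-cases ax-+S = inj₁ (fs (fs (fs fz)) , refl)
PA-cases ax-*0 = inj₁ (fs (fs (fs (fs fz))) , refl)
PA-cases ax-*S = inj₁ (fs (fs (fs (fs (fs fz)))) , refl)
PA-cases (ax-ind ψ) = inj₂ (ψ , refl)

-- The closed codes in basicAxioms are astronomically large numbers, so no
-- goal mentioning axiomCode may be normalised; hence no with-abstraction below.
axiomCode : ℕ → ℕ
axiomCode = enumerate (map code basicAxioms) inductionAxiomCode

axiomCode-basic : ∀ i → axiomCode (toℕ i) ≡ code (lookup basicAxioms i)
axiomCode-basic i = trans (enumerate-lookup (map code basicAxioms) inductionAxiomCode i) (lookup-map i code basicAxioms)

axiomCode-induction : ∀ w → axiomCode (6 + w) ≡ inductionAxiomCode w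
axiomCode-induction = enumerate-beyond (map code basicAxioms) inductionAxiomCode

axiomCode-complete : ∀ {φ} → PA φ → ∃ λ m → axiomCode m ≡ code φ
axiomCode-complete pa = complete (PA-cases pa)
  where
  complete : ∀ {φ} → (∃ λ i → lookup basicAxioms i ≡ φ) ⊎ (∃ λ ψ → closure (indBody ψ) ≡ φ) → ∃ λ m → axiomCode m ≡ code φ
  complete (inj₁ (i , refl)) = toℕ i , axiomCode-basic i
  complete (inj₂ (ψ , refl)) = 6 + encodeF ψ , trans (axiomCode-induction (encodeF ψ)) (inductionAxiomCode-correct (encodeF-code ψ))

axiomCode-sound : ∀ m → Σ Formula λ φ → PA φ × axiomCode m ≡ code φ
axiomCode-sound m = sound (enumerate-cases (map code basicAxioms) inductionAxiomCode m)
  where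
  sound : (∃ λ i → axiomCode m ≡ lookup (map code basicAxioms) i) ⊎ (∃ λ w → axiomCode m ≡ inductionAxiomCode w) →
          Σ Formula λ φ → PA φ × axiomCode m ≡ code φ
  sound (inj₁ (i , e)) = lookup basicAxioms i , basicAxioms-PA i , trans e (lookup-map i code basicAxioms)
  sound (inj₂ (w , e)) = let ψ , c = formulaCode-total w in closure (indBody ψ) , ax-ind ψ , trans e (inductionAxiomCode-correct c)

pr-axiomCode : PrimRec₁ axiomCode
pr-axiomCode = pr-enumerate (map code basicAxioms) {inductionAxiomCode} pr-inductionAxiomCode

PA-RE : ∀ i → REFamily ([ PA ]at i)
PA-RE i = RE-resp (λ n → mk⇔ (image⇒axioms n) (axioms⇒image n))
                  (RE-image {g = λ m → pair (axiomCode m) i} (pairᵖ (pr-comp₁ {f = axiomCode} pr-axiomCode x₀) (pr-const i)))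
  where
  image⇒axioms : ∀ n → (∃ λ m → n ≡ pair (axiomCode m) i) →
                 Σ Formula λ φ → Σ ℕ λ i′ → n ≡ pair (code φ) i′ × ([ PA ]at i) i′ φ
  image⇒axioms n (m , n≡) = let φ , pa , e = axiomCode-sound m in φ , i , trans n≡ (cong (λ c → pair c i) e) , refl , pa
  axioms⇒image : ∀ n → (Σ Formula λ φ → Σ ℕ λ i′ → n ≡ pair (code φ) i′ × ([ PA ]at i) i′ φ) →
                 ∃ λ m → n ≡ pair (axiomCode m) i
  axioms⇒image n (φ , .i , n≡ , refl , pa) = let m , e = axiomCode-complete pa in m , trans n≡ (cong (λ c → pair c i) (sym e))

lemma3p7 : (i : ℕ) → ClosedREGeneric ([ PA ]at i)
lemma3p7 i = PA-RE i , λ U _ _ _ _ _ _ (_ , pa) → 𝓜-models-PA U pa
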